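{- There exists $N_0$ such that the following holds for all $n\ge N_0$. Let $m$ be a positive integer and let $I,J\subseteq[n]=\{1,\dots,n\}$ be arithmetic progressions of cardinality $m$, each with common difference $1$ or $2$. Let $S\subseteq I$, $T\subseteq J$ be nonempty subsets with $|S|+|T|\ge m$, and let $r=m/|S|$. If $2\le r\le 16$ and $m>(\log n)^3$, then there exist $s\in S$ and $t\in T$ that are 2-coprime.
   Context: Two positive integers $s,t$ are 2-coprime if no prime other than $2$ divides both of them. Here $\log$ is the natural logarithm. -}

module Defs where

open import Data.Nat as ℕ using (ℕ; zero; suc; _+_; _*_; _∸_; _≤_; _<_; _!)
open import Data.Nat.Properties using (_!≢0)
open import Data.Nat.Divisibility using (_∣_)
open import Data.Nat.Primality using (Prime)
open import Data.Integer using (+_)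
open import Data.Rational as ℚ using (ℚ; 0ℚ; 1ℚ)
open import Data.Product using (Σ; ∃; _×_)
open import Relation.Binary.PropositionalEquality using (_≡_; _≢_)
open import Relation.Nullary using (¬_)
open import Data.Sum using (_⊎_)

TwoCoprime : ℕ → ℕ → Set
TwoCoprime s t = ∀ p → Prime p → p ≢ 2 → ¬ (p ∣ s × p ∣ t)

InAP : ℕ → ℕ → ℕ → ℕ → Set
InAP a d m x = ∃ λ i → i < m × x ≡ a + d * i

APinRange : ℕ → ℕ → ℕ → ℕ → Set
APinRange n a d m = 1 ≤ a × a + d * (m ∸ 1) ≤ n

Diff12 : ℕ → Set
Diff12 d = d ≡ 1 ⊎ d ≡ 2

qpow : ℚ → ℕ → ℚ
qpow q zero    = 1ℚ
qpow q (suc k) = q ℚ.* qpow q k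

expPartial : ℚ → ℕ → ℚ
expPartial q zero    = 1ℚ
expPartial q (suc K) =
  expPartial q K ℚ.+ qpow q (suc K) ℚ.* ((+ 1) ℚ./ (suc K) !) {{(suc K) !≢0}}

-- (log n)^3 < m  (natural log), for n ≥ 1, expressed without reals:
-- equivalently n < exp(m^{1/3}), i.e. there is a rational q ≥ 0 with
-- q^3 < m and n < exp(q), the latter witnessed by a partial sum.
LogCubedLt : ℕ → ℕ → Set
LogCubedLt n m =
  ∃ λ (q : ℚ) → 0ℚ ℚ.≤ q × qpow q 3 ℚ.< (+ m) ℚ./ 1
    × ∃ λ K → (+ n) ℚ./ 1 ℚ.< expPartial q K

{-# OPTIONS --safe #-}
-- Suppose every s ∈ S shares an odd prime with every t ∈ T and count the k·ℓ pairs (k = |S|,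
-- ℓ = |T| ≥ m - k) by such a prime p. An arithmetic progression of length m with difference 1 or 2
-- has fewer than m/p + 1 multiples of an odd prime p, so p accounts for at most ((m + p)/p)² pairs.
-- Over the primes 17 ≤ p < m this totals less than 0.0183 m²; a prime p ≥ m divides at most one
-- term of J, and each s ≤ n has at most log₂ n ≤ m/10000 prime factors p ≥ m, which is where
-- (log n)³ < m is used. The primes 3, …, 13 are treated by the same union bound when r = m/k < 10/3,
-- since then k(m - k) ≥ 0.21 m² exceeds their share of about 0.186 m². When r ≥ 10/3 one uses instead
-- that a proportion 5760/15015 ≈ 0.3836 of the terms of J avoids them altogether, so each s shares
-- one of them with at most 0.6164 m terms of J, and the k·ℓ ≥ k(m - k) pairs again cannot all be covered.
module Submission where

-- The exponential series

module ExponentialSeries where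

  open import Data.Nat.Base as ℕ using (ℕ; zero; suc; _!)
  import Data.Nat.Properties as ℕ
  open import Data.Nat.Properties using (_!≢0)
  open import Data.Nat.DivMod using (_%_; m/n*n≤m; m≡m%n+[m/n]*n; m%n<n) renaming (_/_ to _div_)
  open import Data.Nat.Coprimality using (1-coprimeTo) renaming (sym to coprime-sym)
  open import Data.Nat.Solver using (module +-*-Solver)
  open import Data.Integer.Base as ℤ using (+_; +≤+; +<+; -[1+_])
  import Data.Integer.Properties as ℤ
  open import Data.Rational.Base using (ℚ; mkℚ; 0ℚ; 1ℚ; _/_; _≤_; _<_; _*_; _+_; *≤*; *<*; nonNegative; positive)
  open import Data.Rational.Properties
  import Data.Rational.Solver as ℚ-Solver
  open import Data.Product using (∃; _×_; _,_)
  open import Relation.Nullary using (yes; no)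
  open import Relation.Binary.PropositionalEquality
  open import Defs using (qpow; expPartial; LogCubedLt)

  open +-*-Solver using (solve; _:=_; _:+_; _:*_; con)
  module QS = ℚ-Solver.+-*-Solver

  ⟦_⟧ : ℕ → ℚ
  ⟦ a ⟧ = + a / 1

  ⟦⟧≡mkℚ : ∀ a → ⟦ a ⟧ ≡ mkℚ (+ a) 0 (coprime-sym (1-coprimeTo a))
  ⟦⟧≡mkℚ a = ↥p/↧p≡p (mkℚ (+ a) 0 (coprime-sym (1-coprimeTo a)))

  ⟦⟧-mono-≤ : ∀ {a b} → a ℕ.≤ b → ⟦ a ⟧ ≤ ⟦ b ⟧
  ⟦⟧-mono-≤ {a} {b} a≤b rewrite ⟦⟧≡mkℚ a | ⟦⟧≡mkℚ b =
    *≤* (subst₂ ℤ._≤_ (sym (ℤ.*-identityʳ (+ a))) (sym (ℤ.*-identityʳ (+ b))) (+≤+ a≤b))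

  ⟦⟧-mono-< : ∀ {a b} → a ℕ.< b → ⟦ a ⟧ < ⟦ b ⟧
  ⟦⟧-mono-< {a} {b} a<b rewrite ⟦⟧≡mkℚ a | ⟦⟧≡mkℚ b =
    *<* (subst₂ ℤ._<_ (sym (ℤ.*-identityʳ (+ a))) (sym (ℤ.*-identityʳ (+ b))) (+<+ a<b))

  ⟦⟧-cancel-< : ∀ {a b} → ⟦ a ⟧ < ⟦ b ⟧ → a ℕ.< b
  ⟦⟧-cancel-< {a} {b} a<b rewrite ⟦⟧≡mkℚ a | ⟦⟧≡mkℚ b =
    ℤ.drop‿+<+ (subst₂ ℤ._<_ (ℤ.*-identityʳ (+ a)) (ℤ.*-identityʳ (+ b)) (drop-*<* a<b))

  ⟦⟧-nonNeg : ∀ a → 0ℚ ≤ ⟦ a ⟧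
  ⟦⟧-nonNeg a = ⟦⟧-mono-≤ {0} {a} ℕ.z≤n

  ⟦⟧-homo-* : ∀ a b → ⟦ a ⟧ * ⟦ b ⟧ ≡ ⟦ a ℕ.* b ⟧
  ⟦⟧-homo-* a b rewrite ⟦⟧≡mkℚ a | ⟦⟧≡mkℚ b = /-cong (sym (ℤ.pos-* a b)) refl

  ⟦⟧-homo-+ : ∀ a b → ⟦ a ⟧ + ⟦ b ⟧ ≡ ⟦ a ℕ.+ b ⟧
  ⟦⟧-homo-+ a b rewrite ⟦⟧≡mkℚ a | ⟦⟧≡mkℚ b =
    /-cong (trans (cong₂ ℤ._+_ (ℤ.*-identityʳ (+ a)) (ℤ.*-identityʳ (+ b))) (sym (ℤ.pos-+ a b))) refl

  ⟦⟧-*-inverse : ∀ e .{{_ : ℕ.NonZero e}} → ⟦ e ⟧ * (+ 1 / e) ≡ 1ℚ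
  ⟦⟧-*-inverse (suc e) rewrite ⟦⟧≡mkℚ (suc e) | ↥p/↧p≡p (mkℚ (+ 1) e (1-coprimeTo (suc e))) =
    *-inverseʳ (mkℚ (+ suc e) 0 (coprime-sym (1-coprimeTo (suc e))))

  1/-nonNeg : ∀ e .{{_ : ℕ.NonZero e}} → 0ℚ ≤ + 1 / e
  1/-nonNeg (suc e) rewrite ↥p/↧p≡p (mkℚ (+ 1) e (1-coprimeTo (suc e))) = *≤* (+≤+ ℕ.z≤n)

  qpow-nonNeg : ∀ {x} j → 0ℚ ≤ x → 0ℚ ≤ qpow x j
  qpow-nonNeg         zero    _   = *≤* (+≤+ ℕ.z≤n)
  qpow-nonNeg {x = x} (suc j) x≥0 = nonNegative⁻¹ (x * qpow x j)
    {{nonNeg*nonNeg⇒nonNeg x {{nonNegative x≥0}} (qpow x j) {{nonNegative (qpow-nonNeg j x≥0)}}}}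

  qpow-monoˡ-≤ : ∀ {x y} j → 0ℚ ≤ x → x ≤ y → qpow x j ≤ qpow y j
  qpow-monoˡ-≤ zero    _   _   = ≤-refl
  qpow-monoˡ-≤ {x} {y} (suc j) x≥0 x≤y =
    ≤-trans (*-monoʳ-≤-nonNeg (qpow x j) {{nonNegative (qpow-nonNeg j x≥0)}} x≤y)
            (*-monoˡ-≤-nonNeg y {{nonNegative (≤-trans x≥0 x≤y)}} (qpow-monoˡ-≤ j x≥0 x≤y))

  qpow-⟦⟧ : ∀ a j → qpow ⟦ a ⟧ j ≡ ⟦ a ℕ.^ j ⟧
  qpow-⟦⟧ a zero    = refl
  qpow-⟦⟧ a (suc j) = trans (cong (⟦ a ⟧ *_) (qpow-⟦⟧ a j)) (⟦⟧-homo-* a (a ℕ.^ j))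

  ^-distribʳ-* : ∀ a b j → (a ℕ.* b) ℕ.^ j ≡ a ℕ.^ j ℕ.* b ℕ.^ j
  ^-distribʳ-* a b zero    = refl
  ^-distribʳ-* a b (suc j) rewrite ^-distribʳ-* a b j =
    solve 4 (λ a b x y → (a :* b) :* (x :* y) := (a :* x) :* (b :* y)) refl a b (a ℕ.^ j) (b ℕ.^ j)

  ^≤^*! : ∀ X j → 1 ℕ.≤ X → X ℕ.^ j ℕ.≤ X ℕ.^ X ℕ.* j !
  ^≤^*! X zero    X≥1 = ℕ.≤-trans (ℕ.^-monoʳ-≤ X {{ℕ.>-nonZero X≥1}} {0} {X} ℕ.z≤n) (ℕ.m≤m*n (X ℕ.^ X) 1)
  ^≤^*! X (suc j) X≥1 with suc j ℕ.≤? X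
  ... | yes 1+j≤X = ℕ.≤-trans (ℕ.^-monoʳ-≤ X {{ℕ.>-nonZero X≥1}} 1+j≤X) (ℕ.m≤m*n (X ℕ.^ X) (suc j !) {{suc j !≢0}})
  ... | no  1+j≰X = begin
    X ℕ.* X ℕ.^ j                  ≤⟨ ℕ.*-mono-≤ (ℕ.<⇒≤ (ℕ.≰⇒> 1+j≰X)) (^≤^*! X j X≥1) ⟩
    suc j ℕ.* (X ℕ.^ X ℕ.* j !)    ≡⟨ solve 3 (λ s y f → s :* (y :* f) := y :* (s :* f)) refl (suc j) (X ℕ.^ X) (j !) ⟩
    X ℕ.^ X ℕ.* (suc j ℕ.* j !)    ∎
    where open ℕ.≤-Reasoning

  selfPower : ℕ → ℕ
  selfPower X = X ℕ.^ X

  selfPower-pos : ∀ X → 1 ℕ.≤ selfPower X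
  selfPower-pos zero    = ℕ.≤-refl
  selfPower-pos (suc X) = ℕ.m^n>0 (suc X) (suc X)

  module _ {q : ℚ} {Q : ℕ} (q≥0 : 0ℚ ≤ q) (q≤Q : q ≤ ⟦ Q ⟧) (Q≥1 : 1 ℕ.≤ Q) where

    private
      X = 2 ℕ.* Q
      Y = selfPower X

    expTerm-bound : ∀ j → (qpow q j * (+ 1 / j !) {{j !≢0}}) * ⟦ 2 ℕ.^ j ⟧ ≤ ⟦ Y ⟧
    expTerm-bound j = begin
      (qpow q j * u) * ⟦ 2 ℕ.^ j ⟧            ≤⟨ *-monoʳ-≤-nonNeg ⟦ 2 ℕ.^ j ⟧ {{nonNegative (⟦⟧-nonNeg (2 ℕ.^ j))}}
                                                    (*-monoʳ-≤-nonNeg u {{nonNegative u≥0}} qʲ≤Qʲ) ⟩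
      (⟦ Q ℕ.^ j ⟧ * u) * ⟦ 2 ℕ.^ j ⟧         ≡⟨ *-swapʳ ⟦ Q ℕ.^ j ⟧ u ⟦ 2 ℕ.^ j ⟧ ⟩
      (⟦ Q ℕ.^ j ⟧ * ⟦ 2 ℕ.^ j ⟧) * u         ≡⟨ cong (_* u) (trans (⟦⟧-homo-* (Q ℕ.^ j) (2 ℕ.^ j)) (cong ⟦_⟧ 2ʲQʲ≡Xʲ)) ⟩
      ⟦ X ℕ.^ j ⟧ * u                          ≤⟨ *-monoʳ-≤-nonNeg u {{nonNegative u≥0}} (⟦⟧-mono-≤ (^≤^*! X j X≥1)) ⟩
      ⟦ Y ℕ.* j ! ⟧ * u                        ≡⟨ cong (_* u) (sym (⟦⟧-homo-* Y (j !))) ⟩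
      (⟦ Y ⟧ * ⟦ j ! ⟧) * u                    ≡⟨ trans (*-assoc ⟦ Y ⟧ ⟦ j ! ⟧ u) (cong (⟦ Y ⟧ *_) (⟦⟧-*-inverse (j !) {{j !≢0}})) ⟩
      ⟦ Y ⟧ * 1ℚ                               ≡⟨ *-identityʳ ⟦ Y ⟧ ⟩
      ⟦ Y ⟧                                    ∎
      where
      open ≤-Reasoning
      u = (+ 1 / j !) {{j !≢0}}
      *-swapʳ : ∀ a b c → (a * b) * c ≡ (a * c) * b
      *-swapʳ a b c = trans (*-assoc a b c) (trans (cong (a *_) (*-comm b c)) (sym (*-assoc a c b)))
      u≥0 : 0ℚ ≤ u
      u≥0 = 1/-nonNeg (j !) {{j !≢0}}
      qʲ≤Qʲ : qpow q j ≤ ⟦ Q ℕ.^ j ⟧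
      qʲ≤Qʲ = subst (qpow q j ≤_) (qpow-⟦⟧ Q j) (qpow-monoˡ-≤ j q≥0 q≤Q)
      2ʲQʲ≡Xʲ : Q ℕ.^ j ℕ.* 2 ℕ.^ j ≡ X ℕ.^ j
      2ʲQʲ≡Xʲ = trans (ℕ.*-comm (Q ℕ.^ j) (2 ℕ.^ j)) (sym (^-distribʳ-* 2 Q j))
      X≥1 : 1 ℕ.≤ X
      X≥1 = ℕ.≤-trans Q≥1 (ℕ.m≤n*m Q 2)

    private
      ⟦2^⟧ : ℕ → ℚ
      ⟦2^⟧ K = ⟦ 2 ℕ.^ K ⟧

      ⟦2^⟧-suc : ∀ K → ⟦2^⟧ (suc K) ≡ ⟦2^⟧ K + ⟦2^⟧ K
      ⟦2^⟧-suc K = trans (cong ⟦_⟧ (cong (2 ℕ.^ K ℕ.+_) (ℕ.+-identityʳ (2 ℕ.^ K)))) (sym (⟦⟧-homo-+ (2 ℕ.^ K) (2 ℕ.^ K)))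

    -- Each term is at most Y/2^j, so the partial sums stay below 2Y.
    expPartial-doubling : ∀ K → expPartial q K * ⟦2^⟧ K + ⟦ Y ⟧ ≤ ⟦ 2 ℕ.^ suc K ℕ.* Y ⟧
    expPartial-doubling zero = begin
      1ℚ * ⟦ 1 ⟧ + ⟦ Y ⟧     ≡⟨ cong (_+ ⟦ Y ⟧) (*-identityˡ ⟦ 1 ⟧) ⟩
      ⟦ 1 ⟧ + ⟦ Y ⟧          ≡⟨ ⟦⟧-homo-+ 1 Y ⟩
      ⟦ 1 ℕ.+ Y ⟧            ≤⟨ ⟦⟧-mono-≤ (ℕ.+-monoˡ-≤ Y (ℕ.≤-trans (selfPower-pos X) (ℕ.m≤m+n Y 0))) ⟩
      ⟦ Y ℕ.+ 0 ℕ.+ Y ⟧      ≡⟨ cong ⟦_⟧ (ℕ.+-comm (Y ℕ.+ 0) Y) ⟩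
      ⟦ 2 ℕ.* Y ⟧            ∎
      where open ≤-Reasoning
    expPartial-doubling (suc K) = begin
      (E + t) * ⟦2^⟧ (suc K) + ⟦ Y ⟧              ≡⟨ cong (λ z → (E + t) * z + ⟦ Y ⟧) (⟦2^⟧-suc K) ⟩
      (E + t) * (P + P) + ⟦ Y ⟧                   ≡⟨ QS.solve 4 (λ E t P Y → (E QS.:+ t) QS.:* (P QS.:+ P) QS.:+ Y
                                                         QS.:= (E QS.:* P QS.:+ Y) QS.:+ (E QS.:* P QS.:+ t QS.:* (P QS.:+ P)))
                                                         refl E t P ⟦ Y ⟧ ⟩
      (E * P + ⟦ Y ⟧) + (E * P + t * (P + P))     ≡⟨ cong (λ z → (E * P + ⟦ Y ⟧) + (E * P + t * z)) (⟦2^⟧-suc K) ⟨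
      (E * P + ⟦ Y ⟧) + (E * P + t * ⟦2^⟧ (suc K)) ≤⟨ +-monoʳ-≤ (E * P + ⟦ Y ⟧) (+-monoʳ-≤ (E * P) (expTerm-bound (suc K))) ⟩
      (E * P + ⟦ Y ⟧) + (E * P + ⟦ Y ⟧)           ≤⟨ +-mono-≤ (expPartial-doubling K) (expPartial-doubling K) ⟩
      ⟦ Z ⟧ + ⟦ Z ⟧                               ≡⟨ ⟦⟧-homo-+ Z Z ⟩
      ⟦ Z ℕ.+ Z ⟧                                 ≡⟨ cong ⟦_⟧ (solve 2 (λ a y → a :* y :+ a :* y := (con 2 :* a) :* y) refl (2 ℕ.^ suc K) Y) ⟩
      ⟦ 2 ℕ.^ suc (suc K) ℕ.* Y ⟧                 ∎
      where
      open ≤-Reasoning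
      E = expPartial q K
      t = qpow q (suc K) * (+ 1 / suc K !) {{suc K !≢0}}
      P = ⟦2^⟧ K
      Z = 2 ℕ.^ suc K ℕ.* Y

    expPartial-bound : ∀ K → expPartial q K ≤ ⟦ 2 ℕ.* Y ⟧
    expPartial-bound K = *-cancelʳ-≤-pos (⟦2^⟧ K) {{positive (⟦⟧-mono-< (ℕ.m^n>0 2 K))}} (begin
      E * ⟦2^⟧ K                  ≤⟨ subst (_≤ E * ⟦2^⟧ K + ⟦ Y ⟧) (+-identityʳ (E * ⟦2^⟧ K)) (+-monoʳ-≤ (E * ⟦2^⟧ K) (⟦⟧-nonNeg Y)) ⟩
      E * ⟦2^⟧ K + ⟦ Y ⟧          ≤⟨ expPartial-doubling K ⟩
      ⟦ 2 ℕ.^ suc K ℕ.* Y ⟧       ≡⟨ cong ⟦_⟧ (solve 2 (λ a y → (con 2 :* a) :* y := (con 2 :* y) :* a) refl (2 ℕ.^ K) Y) ⟩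
      ⟦ 2 ℕ.* Y ℕ.* 2 ℕ.^ K ⟧     ≡⟨ ⟦⟧-homo-* (2 ℕ.* Y) (2 ℕ.^ K) ⟨
      ⟦ 2 ℕ.* Y ⟧ * ⟦2^⟧ K        ∎)
      where
      open ≤-Reasoning
      E = expPartial q K

  m<[m/n+1]*n : ∀ m n .{{_ : ℕ.NonZero n}} → m ℕ.< (m div n ℕ.+ 1) ℕ.* n
  m<[m/n+1]*n m n = begin-strict
    m                            ≡⟨ m≡m%n+[m/n]*n m n ⟩
    m % n ℕ.+ m div n ℕ.* n      <⟨ ℕ.+-monoˡ-< (m div n ℕ.* n) (m%n<n m n) ⟩
    n ℕ.+ m div n ℕ.* n          ≡⟨ solve 2 (λ n f → n :+ f :* n := (f :+ con 1) :* n) refl n (m div n) ⟩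
    (m div n ℕ.+ 1) ℕ.* n        ∎
    where open ℕ.≤-Reasoning

  -- With F = ⌊q⌋: F³ ≤ q³ < m, and n < exp q ≤ 2 (2(F+1))^(2(F+1)).
  logCubed⇒ : ∀ {n m} → LogCubedLt n m →
              ∃ λ F → F ℕ.* (F ℕ.* F) ℕ.< m × n ℕ.< 2 ℕ.* selfPower (2 ℕ.* (F ℕ.+ 1))
  logCubed⇒ (mkℚ -[1+ _ ] _ _ , *≤* () , _)
  logCubed⇒ {n} {m} (q@(mkℚ (+ a) b-1 _) , q≥0 , q³<m , K , n<expq) = F , F³<m , n<2Y
    where
    b = suc b-1
    F = a div b
    F≤q : ⟦ F ⟧ ≤ q
    F≤q rewrite ⟦⟧≡mkℚ F = *≤* (subst₂ ℤ._≤_ (ℤ.pos-* F b) (sym (ℤ.*-identityʳ (+ a))) (+≤+ (m/n*n≤m a b)))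
    q≤F+1 : q ≤ ⟦ F ℕ.+ 1 ⟧
    q≤F+1 rewrite ⟦⟧≡mkℚ (F ℕ.+ 1) =
      *≤* (subst₂ ℤ._≤_ (sym (ℤ.*-identityʳ (+ a))) (ℤ.pos-* (F ℕ.+ 1) b) (+≤+ (ℕ.<⇒≤ (m<[m/n+1]*n a b))))
    F³<m : F ℕ.* (F ℕ.* F) ℕ.< m
    F³<m = subst (ℕ._< m) (cong (λ z → F ℕ.* (F ℕ.* z)) (ℕ.*-identityʳ F))
             (⟦⟧-cancel-< (≤-<-trans (≤-reflexive (sym (qpow-⟦⟧ F 3)))
                                     (≤-<-trans (qpow-monoˡ-≤ 3 (⟦⟧-nonNeg F) F≤q) q³<m)))
    n<2Y : n ℕ.< 2 ℕ.* selfPower (2 ℕ.* (F ℕ.+ 1))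
    n<2Y = ⟦⟧-cancel-< (<-≤-trans n<expq (expPartial-bound q≥0 q≤F+1 (ℕ.m≤n+m 1 F) K))

open import Defs
open import Data.Nat using (ℕ; _≤_; _*_; _+_)
open import Data.List using (List; length)
open import Data.List.Relation.Unary.All using (All)
open import Data.List.Relation.Unary.Unique.Propositional using (Unique)
open import Data.List.Membership.Propositional using (_∈_)
open import Data.Product using (∃; _×_)

open import Data.Nat
open import Data.Nat.Properties
open import Data.Nat.DivMod using (m≡m%n+[m/n]*n; m%n<n; m/n*n≤m)
open import Data.Nat.Divisibility using (_∣_; _∣?_; ∣⇒≤; ∣m+n∣m⇒∣n; ∣m∣n⇒∣m+n; ∣n⇒∣m*n; divides)
open import Data.Nat.Coprimality using (Coprime; coprime-divisor; prime⇒coprime)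
open import Data.Nat.Primality using (Prime; prime?; euclidsLemma; prime⇒irreducible; prime⇒nonTrivial)
open import Data.Nat.Induction using (<-rec)
open import Data.Nat.Solver using (module +-*-Solver)
open import Data.List using ([]; _∷_; filter)
open import Data.List.Properties using (filter-all; filter-accept; filter-reject)
open import Data.List.Membership.Propositional using (find)
open import Data.List.Membership.DecPropositional _≟_ using (_∈?_)
open import Data.List.Relation.Unary.All using ([]; _∷_; all?; lookup)
import Data.List.Relation.Unary.All as All
open import Data.List.Relation.Unary.All.Properties using (all-filter; All¬⇒¬Any; ¬All⇒Any¬) renaming (filter⁺ to All-filter⁺)
open import Data.List.Relation.Unary.Any using (Any; here; there; any?)
import Data.List.Relation.Unary.Any as Any
open import Data.List.Relation.Unary.Unique.Propositional.Properties using () renaming (filter⁺ to Unique-filter⁺)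
open import Data.List.Relation.Unary.AllPairs using ([]; _∷_)
open import Data.Product using (_,_; proj₁; proj₂)
open import Data.Sum using (_⊎_; inj₁; inj₂)
open import Data.Empty using (⊥; ⊥-elim)
open import Function using (_∘_; case_of_)
open import Relation.Nullary using (Dec; yes; no; ¬_; ¬?)
open import Relation.Nullary.Decidable using (from-yes; _×-dec_; _→-dec_)
open import Relation.Unary using (Decidable)
open import Relation.Binary.PropositionalEquality
  using (_≡_; _≢_; refl; sym; trans; cong; cong₂; subst; subst₂; module ≡-Reasoning)

open +-*-Solver using (solve; _:=_; _:+_; _:*_; con)
open ExponentialSeries using (selfPower; logCubed⇒)

-- Indicators and finite sums

𝟙 : ∀ {p} {P : Set p} → Dec P → ℕ
𝟙 (yes _) = 1
𝟙 (no _)  = 0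

𝟙≤1 : ∀ {p} {P : Set p} (P? : Dec P) → 𝟙 P? ≤ 1
𝟙≤1 (yes _) = ≤-refl
𝟙≤1 (no _)  = z≤n

𝟙-yes : ∀ {p} {P : Set p} (P? : Dec P) → P → 𝟙 P? ≡ 1
𝟙-yes (yes _) _ = refl
𝟙-yes (no ¬p) p = ⊥-elim (¬p p)

𝟙-no : ∀ {p} {P : Set p} (P? : Dec P) → ¬ P → 𝟙 P? ≡ 0
𝟙-no (yes p) ¬p = ⊥-elim (¬p p)
𝟙-no (no _)  _  = refl

𝟙-witness : ∀ {p} {P : Set p} (P? : Dec P) → 1 ≤ 𝟙 P? → P
𝟙-witness (yes p) _ = p

𝟙-mono : ∀ {p q} {P : Set p} {Q : Set q} (P? : Dec P) (Q? : Dec Q) → (P → Q) → 𝟙 P? ≤ 𝟙 Q?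
𝟙-mono (yes p) (yes _) _   = ≤-refl
𝟙-mono (yes p) (no ¬q) P⇒Q = ⊥-elim (¬q (P⇒Q p))
𝟙-mono (no _)  _       _   = z≤n

𝟙-cong : ∀ {p q} {P : Set p} {Q : Set q} (P? : Dec P) (Q? : Dec Q) → (P → Q) → (Q → P) → 𝟙 P? ≡ 𝟙 Q?
𝟙-cong P? Q? P⇒Q Q⇒P = ≤-antisym (𝟙-mono P? Q? P⇒Q) (𝟙-mono Q? P? Q⇒P)

𝟙-× : ∀ {p q} {P : Set p} {Q : Set q} (P? : Dec P) (Q? : Dec Q) → 𝟙 (P? ×-dec Q?) ≡ 𝟙 P? * 𝟙 Q?
𝟙-× (yes _) (yes _) = refl
𝟙-× (yes _) (no _)  = refl
𝟙-× (no _)  _       = refl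

∑< : ℕ → (ℕ → ℕ) → ℕ
∑< zero    f = 0
∑< (suc n) f = ∑< n f + f n

syntax ∑< n (λ i → e) = ∑[ i < n ] e

module _ {f g : ℕ → ℕ} where

  ∑<-cong : ∀ n → (∀ i → i < n → f i ≡ g i) → ∑< n f ≡ ∑< n g
  ∑<-cong zero    _   = refl
  ∑<-cong (suc n) f≡g = cong₂ _+_ (∑<-cong n (λ i → f≡g i ∘ m≤n⇒m≤1+n)) (f≡g n ≤-refl)

  ∑<-mono : ∀ n → (∀ i → i < n → f i ≤ g i) → ∑< n f ≤ ∑< n g
  ∑<-mono zero    _   = z≤n
  ∑<-mono (suc n) f≤g = +-mono-≤ (∑<-mono n (λ i → f≤g i ∘ m≤n⇒m≤1+n)) (f≤g n ≤-refl)

  ∑<-distrib-+ : ∀ n → ∑[ i < n ] (f i + g i) ≡ ∑< n f + ∑< n g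
  ∑<-distrib-+ zero    = refl
  ∑<-distrib-+ (suc n) rewrite ∑<-distrib-+ n =
    solve 4 (λ a b c d → (a :+ b) :+ (c :+ d) := (a :+ c) :+ (b :+ d)) refl
      (∑< n f) (∑< n g) (f n) (g n)

∑<-*ˡ : ∀ n c (f : ℕ → ℕ) → ∑[ i < n ] (c * f i) ≡ c * ∑< n f
∑<-*ˡ zero    c f = sym (*-zeroʳ c)
∑<-*ˡ (suc n) c f rewrite ∑<-*ˡ n c f = sym (*-distribˡ-+ c (∑< n f) (f n))

∑<-*ʳ : ∀ n c (f : ℕ → ℕ) → ∑[ i < n ] (f i * c) ≡ ∑< n f * c
∑<-*ʳ zero    c f = refl
∑<-*ʳ (suc n) c f rewrite ∑<-*ʳ n c f = sym (*-distribʳ-+ c (∑< n f) (f n))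

∑<-const : ∀ n c → ∑[ i < n ] c ≡ n * c
∑<-const zero    c = refl
∑<-const (suc n) c rewrite ∑<-const n c = +-comm (n * c) c

∑<-split : ∀ x y (f : ℕ → ℕ) → ∑< (x + y) f ≡ ∑< x f + ∑[ i < y ] f (x + i)
∑<-split x zero    f rewrite +-identityʳ x = sym (+-identityʳ _)
∑<-split x (suc y) f rewrite +-suc x y | ∑<-split x y f = +-assoc (∑< x f) _ _

∑<-split-at : ∀ {b c} (f : ℕ → ℕ) → b ≤ c → ∑< c f ≡ ∑< b f + ∑[ i < c ∸ b ] f (b + i)
∑<-split-at {b} {c} f b≤c = trans (cong (λ z → ∑< z f) (sym (m+[n∸m]≡n b≤c))) (∑<-split b (c ∸ b) f)

∑<-prefix : ∀ {x y} (f : ℕ → ℕ) → x ≤ y → ∑< x f ≤ ∑< y f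
∑<-prefix {x} f x≤y with o , refl ← m≤n⇒∃[o]m+o≡n x≤y rewrite ∑<-split x o f = m≤m+n _ _

∑<-comm : ∀ a b (f : ℕ → ℕ → ℕ) → ∑[ i < a ] ∑[ j < b ] f i j ≡ ∑[ j < b ] ∑[ i < a ] f i j
∑<-comm zero    b f = sym (trans (∑<-const b 0) (*-zeroʳ b))
∑<-comm (suc a) b f rewrite ∑<-comm a b f = sym (∑<-distrib-+ b)

≤∑< : ∀ n (f : ℕ → ℕ) {i} → i < n → f i ≤ ∑< n f
≤∑< (suc n) f {i} i<1+n with i ≟ n
... | yes refl = m≤n+m (f i) (∑< n f)
... | no i≢n   = ≤-trans (≤∑< n f (≤∧≢⇒< (≤-pred i<1+n) i≢n)) (m≤m+n (∑< n f) (f n))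

∑<-rotate : ∀ n (f : ℕ → ℕ) → ∑[ i < n ] f (suc i) + f 0 ≡ ∑< n f + f n
∑<-rotate zero    f = refl
∑<-rotate (suc n) f = begin
  ∑[ i < n ] f (suc i) + f (suc n) + f 0   ≡⟨ solve 3 (λ a b c → a :+ b :+ c := a :+ c :+ b) refl
                                                  (∑[ i < n ] f (suc i)) (f (suc n)) (f 0) ⟩
  ∑[ i < n ] f (suc i) + f 0 + f (suc n)   ≡⟨ cong (_+ f (suc n)) (∑<-rotate n f) ⟩
  ∑< n f + f n + f (suc n)                 ∎
  where open ≡-Reasoning

∑<-periodic-shift : ∀ P (h : ℕ → ℕ) → h P ≡ h 0 → ∑[ i < P ] h (suc i) ≡ ∑< P h
∑<-periodic-shift P h hP≡h0 =
  +-cancelʳ-≡ (h 0) _ _ (trans (∑<-rotate P h) (cong (∑< P h +_) hP≡h0))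

∑<-atMostOne : ∀ n (f : ℕ → ℕ) → (∀ i → i < n → f i ≤ 1) →
               (∀ i j → i < j → j < n → 1 ≤ f i → 1 ≤ f j → ⊥) → ∑< n f ≤ 1
∑<-atMostOne zero    f _   _   = z≤n
∑<-atMostOne (suc n) f f≤1 two with f n in fn≡
... | zero rewrite +-identityʳ (∑< n f) =
  ∑<-atMostOne n f (λ i → f≤1 i ∘ m≤n⇒m≤1+n) (λ i j i<j j<n → two i j i<j (m≤n⇒m≤1+n j<n))
... | suc _ = subst₂ (λ z w → z + w ≤ 1) (sym ∑<-zero) fn≡ (f≤1 n ≤-refl)
  where
  fn≥1 : 1 ≤ f n
  fn≥1 rewrite fn≡ = s≤s z≤n
  ∑<-zero : ∑< n f ≡ 0
  ∑<-zero = trans (∑<-cong n (λ i i<n → n≤0⇒n≡0 (≮⇒≥ λ fi≥1 → two i n i<n ≤-refl fi≥1 fn≥1)))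
                  (trans (∑<-const n 0) (*-zeroʳ n))

∑<-sparse : ∀ {p} (f : ℕ → ℕ) → 1 ≤ p → (∀ x → ∑[ i < p ] f (x + i) ≤ 1) →
            ∀ m → p * ∑< m f < m + p
∑<-sparse {p} f p≥1 window = <-rec _ bound
  where
  open ≤-Reasoning
  bound : ∀ m → (∀ {o} → o < m → p * ∑< o f < o + p) → p * ∑< m f < m + p
  bound zero      _ rewrite *-zeroʳ p = p≥1
  bound m@(suc _) rec with m <? p
  ... | yes m<p = begin-strict
    p * ∑< m f  ≤⟨ *-monoʳ-≤ p (≤-trans (∑<-prefix f (<⇒≤ m<p)) (window 0)) ⟩
    p * 1       ≡⟨ *-identityʳ p ⟩
    p           <⟨ m<n+m p z<s ⟩
    m + p       ∎
  ... | no m≮p = subst (λ z → p * ∑< z f < z + p) (m∸n+n≡m p≤m) (begin-strict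
    p * ∑< (o + p) f                    ≡⟨ cong (p *_) (∑<-split o p f) ⟩
    p * (∑< o f + ∑[ i < p ] f (o + i)) ≤⟨ *-monoʳ-≤ p (+-monoʳ-≤ (∑< o f) (window o)) ⟩
    p * (∑< o f + 1)                    ≡⟨ solve 2 (λ p s → p :* (s :+ con 1) := p :* s :+ p) refl p (∑< o f) ⟩
    p * ∑< o f + p                      <⟨ +-monoˡ-< p (rec (∸-monoʳ-< p≥1 p≤m)) ⟩
    o + p + p                           ∎)
    where
    p≤m = ≮⇒≥ m≮p
    o = m ∸ p

∑<-blocks : ∀ {P K} (h : ℕ → ℕ) → (∀ x → ∑[ i < P ] h (x + i) ≡ K) → ∀ q → ∑< (q * P) h ≡ q * K
∑<-blocks         h window zero    = refl
∑<-blocks {P} {K} h window (suc q) = begin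
  ∑< (P + q * P) h                         ≡⟨ ∑<-split P (q * P) h ⟩
  ∑< P h + ∑[ i < q * P ] h (P + i)         ≡⟨ cong₂ _+_ (window 0) (∑<-blocks (h ∘ (P +_)) shifted q) ⟩
  K + q * K                                ∎
  where
  open ≡-Reasoning
  shifted : ∀ x → ∑[ i < P ] h (P + (x + i)) ≡ K
  shifted x = trans (∑<-cong P (λ i _ → cong h (sym (+-assoc P x i)))) (window (P + x))

∑<-blocks-lower : ∀ {P K} .{{_ : NonZero P}} (h : ℕ → ℕ) → (∀ x → ∑[ i < P ] h (x + i) ≡ K) →
                  ∀ m → m * K ≤ ∑< m h * P + (P ∸ 1) * K
∑<-blocks-lower {P} {K} h window m = begin
  m * K                                    ≡⟨ cong (_* K) (m≡m%n+[m/n]*n m P) ⟩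
  (m % P + q * P) * K                      ≡⟨ *-distribʳ-+ K (m % P) (q * P) ⟩
  m % P * K + q * P * K                    ≤⟨ +-monoˡ-≤ (q * P * K) (*-monoˡ-≤ K (≤-pred (subst (m % P <_) (sym (suc-pred P)) (m%n<n m P)))) ⟩
  (P ∸ 1) * K + q * P * K                  ≡⟨ cong ((P ∸ 1) * K +_) (solve 3 (λ q p k → q :* p :* k := q :* k :* p) refl q P K) ⟩
  (P ∸ 1) * K + q * K * P                  ≡⟨ cong (λ z → (P ∸ 1) * K + z * P) (∑<-blocks h window q) ⟨
  (P ∸ 1) * K + ∑< (q * P) h * P           ≤⟨ +-monoʳ-≤ ((P ∸ 1) * K) (*-monoˡ-≤ P (∑<-prefix h (m/n*n≤m m P))) ⟩
  (P ∸ 1) * K + ∑< m h * P                 ≡⟨ +-comm ((P ∸ 1) * K) _ ⟩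
  ∑< m h * P + (P ∸ 1) * K                 ∎
  where
  open ≤-Reasoning
  q = m / P

-- ∑_{j > b} 1/j² ≤ 1/b, via the telescoping bound 1/j² ≤ 1/(j-1) - 1/j.
∑<-inverseSquares : ∀ {R} b L (v : ℕ → ℕ) → (∀ i → i < L → (suc b + i) * (suc b + i) * v i ≤ R) →
                    ∑< L v * b ≤ R
∑<-inverseSquares {R} zero    L v _     = ≤-trans (≤-reflexive (*-zeroʳ (∑< L v))) z≤n
∑<-inverseSquares {R} (suc c) L v bound =
  *-cancelʳ-≤ (∑< L v * b) R (b + L) (≤-trans (telescope L (λ i → bound i)) (*-monoʳ-≤ R (m≤n+m L b)))
  where
  b = suc c
  telescope : ∀ L → (∀ i → i < L → (suc b + i) * (suc b + i) * v i ≤ R) → ∑< L v * b * (b + L) ≤ R * L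
  telescope zero    _     = z≤n
  telescope (suc L) bound = *-cancelʳ-≤ _ _ M {{>-nonZero (m≤n⇒m≤n+o L (s≤s z≤n))}} (begin
    (A + w) * b * (b + suc L) * M                   ≡⟨ solve 4 (λ A w b L → (A :+ w) :* b :* (b :+ (con 1 :+ L)) :* (b :+ L)
                                                          := A :* b :* (b :+ L) :* (b :+ L :+ con 1) :+ b :* ((con 1 :+ (b :+ L)) :* (b :+ L) :* w))
                                                          refl A w b L ⟩
    A * b * M * (M + 1) + b * (suc M * M * w)       ≤⟨ +-mono-≤ (*-monoˡ-≤ (M + 1) (telescope L (λ i → bound i ∘ m≤n⇒m≤1+n)))
                                                               (*-monoʳ-≤ b (≤-trans (*-monoˡ-≤ w (*-monoʳ-≤ (suc M) (n≤1+n M))) (bound L ≤-refl))) ⟩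
    R * L * (M + 1) + b * R                         ≡⟨ solve 3 (λ R L b → R :* L :* (b :+ L :+ con 1) :+ b :* R := R :* (con 1 :+ L) :* (b :+ L))
                                                          refl R L b ⟩
    R * suc L * M                                   ∎)
    where
    open ≤-Reasoning
    A = ∑< L v
    w = v L
    M = b + L

∑∈ : List ℕ → (ℕ → ℕ) → ℕ
∑∈ []       f = 0
∑∈ (x ∷ xs) f = f x + ∑∈ xs f

syntax ∑∈ xs (λ x → e) = ∑[ x ∈ xs ] e

module _ {f g : ℕ → ℕ} where

  ∑∈-mono : ∀ xs → All (λ x → f x ≤ g x) xs → ∑∈ xs f ≤ ∑∈ xs g
  ∑∈-mono []       []         = z≤n
  ∑∈-mono (x ∷ xs) (fx≤ ∷ f≤) = +-mono-≤ fx≤ (∑∈-mono xs f≤)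

  ∑∈-distrib-+ : ∀ xs → ∑[ x ∈ xs ] (f x + g x) ≡ ∑∈ xs f + ∑∈ xs g
  ∑∈-distrib-+ []       = refl
  ∑∈-distrib-+ (x ∷ xs) rewrite ∑∈-distrib-+ xs =
    solve 4 (λ a b c d → (a :+ b) :+ (c :+ d) := (a :+ c) :+ (b :+ d)) refl
      (f x) (g x) (∑∈ xs f) (∑∈ xs g)

∑∈-mono′ : ∀ xs {f g : ℕ → ℕ} → (∀ x → f x ≤ g x) → ∑∈ xs f ≤ ∑∈ xs g
∑∈-mono′ xs f≤g = ∑∈-mono xs (All.tabulate λ {x} _ → f≤g x)

∑∈-cong : ∀ xs {f g : ℕ → ℕ} → (∀ x → f x ≡ g x) → ∑∈ xs f ≡ ∑∈ xs g
∑∈-cong []       f≡g = refl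
∑∈-cong (x ∷ xs) f≡g = cong₂ _+_ (f≡g x) (∑∈-cong xs f≡g)

∑∈-*ˡ : ∀ xs c (f : ℕ → ℕ) → ∑[ x ∈ xs ] (c * f x) ≡ c * ∑∈ xs f
∑∈-*ˡ []       c f = sym (*-zeroʳ c)
∑∈-*ˡ (x ∷ xs) c f rewrite ∑∈-*ˡ xs c f = sym (*-distribˡ-+ c (f x) (∑∈ xs f))

∑∈-*ʳ : ∀ xs c (f : ℕ → ℕ) → ∑[ x ∈ xs ] (f x * c) ≡ ∑∈ xs f * c
∑∈-*ʳ []       c f = refl
∑∈-*ʳ (x ∷ xs) c f rewrite ∑∈-*ʳ xs c f = sym (*-distribʳ-+ c (f x) (∑∈ xs f))

∑∈-const : ∀ xs c → ∑[ x ∈ xs ] c ≡ length xs * c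
∑∈-const []       c = refl
∑∈-const (x ∷ xs) c = cong (c +_) (∑∈-const xs c)

∑∈-∑<-comm : ∀ xs n (f : ℕ → ℕ → ℕ) → ∑[ x ∈ xs ] ∑[ i < n ] f x i ≡ ∑[ i < n ] ∑[ x ∈ xs ] f x i
∑∈-∑<-comm []       n f = sym (trans (∑<-const n 0) (*-zeroʳ n))
∑∈-∑<-comm (x ∷ xs) n f rewrite ∑∈-∑<-comm xs n f = sym (∑<-distrib-+ n)

∑∈-comm : ∀ xs ys (f : ℕ → ℕ → ℕ) → ∑[ x ∈ xs ] ∑[ y ∈ ys ] f x y ≡ ∑[ y ∈ ys ] ∑[ x ∈ xs ] f x y
∑∈-comm []       ys f = sym (trans (∑∈-const ys 0) (*-zeroʳ (length ys)))
∑∈-comm (x ∷ xs) ys f rewrite ∑∈-comm xs ys f = sym (∑∈-distrib-+ ys)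

module _ (g : ℕ → ℕ) where

  private
    ∑∈-filter : ∀ y xs → Unique xs → ∑∈ xs g ≤ ∑∈ (filter (¬? ∘ (_≟ y)) xs) g + g y
    ∑∈-filter y []       []           = z≤n
    ∑∈-filter y (x ∷ xs) (x∉xs ∷ uxs) with x ≟ y
    ... | yes refl
      rewrite filter-reject (¬? ∘ (_≟ x)) {xs = xs} (λ x≢x → x≢x refl)
            | filter-all (¬? ∘ (_≟ x)) (All.map (λ x≢z z≡x → x≢z (sym z≡x)) x∉xs) =
      ≤-reflexive (+-comm (g x) (∑∈ xs g))
    ... | no x≢y
      rewrite filter-accept (¬? ∘ (_≟ y)) {xs = xs} x≢y
            | +-assoc (g x) (∑∈ (filter (¬? ∘ (_≟ y)) xs) g) (g y) =
      +-monoʳ-≤ (g x) (∑∈-filter y xs uxs)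

  ∑∈-image≤∑< : ∀ m (f : ℕ → ℕ) xs → Unique xs → All (λ x → ∃ λ i → i < m × x ≡ f i) xs →
                ∑∈ xs g ≤ ∑[ i < m ] g (f i)
  ∑∈-image≤∑< zero    f []       _ _                    = z≤n
  ∑∈-image≤∑< zero    f (_ ∷ _)  _ ((_ , () , _) ∷ _)
  ∑∈-image≤∑< (suc m) f xs uxs xs⊆f[m+1] = begin
    ∑∈ xs g                     ≤⟨ ∑∈-filter (f m) xs uxs ⟩
    ∑∈ xs′ g + g (f m)          ≤⟨ +-monoˡ-≤ (g (f m)) (∑∈-image≤∑< m f xs′ (Unique-filter⁺ _ uxs) xs′⊆f[m]) ⟩
    ∑[ i < m ] g (f i) + g (f m) ∎
    where
    open ≤-Reasoning
    xs′ = filter (¬? ∘ (_≟ f m)) xs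
    below-m : ∀ {x} → (∃ λ i → i < suc m × x ≡ f i) → x ≢ f m → ∃ λ i → i < m × x ≡ f i
    below-m (i , i<1+m , x≡fi) x≢fm with i ≟ m
    ... | yes refl = ⊥-elim (x≢fm x≡fi)
    ... | no i≢m   = i , ≤∧≢⇒< (≤-pred i<1+m) i≢m , x≡fi
    xs′⊆f[m] : All (λ x → ∃ λ i → i < m × x ≡ f i) xs′
    xs′⊆f[m] = All.zipWith (λ (x∈ , x≢) → below-m x∈ x≢)
                 (All-filter⁺ _ xs⊆f[m+1] , all-filter (¬? ∘ (_≟ f m)) xs)

𝟙-any≤∑∈ : ∀ {p} {P : ℕ → Set p} (P? : Decidable P) xs → 𝟙 (any? P? xs) ≤ ∑[ x ∈ xs ] 𝟙 (P? x)
𝟙-any≤∑∈ P? []       = z≤n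
𝟙-any≤∑∈ P? (x ∷ xs) with any? P? (x ∷ xs)
... | no _            = z≤n
... | yes (here px)   = m≤n⇒m≤n+o _ (≤-reflexive (sym (𝟙-yes (P? x) px)))
... | yes (there pxs) = m≤n⇒m≤o+n (𝟙 (P? x)) (≤-trans (≤-reflexive (sym (𝟙-yes (any? P? xs) pxs))) (𝟙-any≤∑∈ P? xs))

⌈_/_⌉ : ℕ → ℕ → ℕ
⌈ a / zero  ⌉ = 0
⌈ a / suc b ⌉ = (a + b) / suc b

≤⌈/⌉* : ∀ a {b} → 1 ≤ b → a ≤ ⌈ a / b ⌉ * b
≤⌈/⌉* a {suc b} _ = +-cancelˡ-≤ b a (⌈ a / suc b ⌉ * suc b) (begin
  b + a                                    ≡⟨ +-comm b a ⟩
  a + b                                    ≡⟨ m≡m%n+[m/n]*n (a + b) (suc b) ⟩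
  (a + b) % suc b + ⌈ a / suc b ⌉ * suc b  ≤⟨ +-monoˡ-≤ _ (≤-pred (m%n<n (a + b) (suc b))) ⟩
  b + ⌈ a / suc b ⌉ * suc b                ∎)
  where open ≤-Reasoning

-- Multiples of primes in arithmetic progressions

APinRange⇒length≤n : ∀ {n a d m} → 1 ≤ m → Diff12 d → APinRange n a d m → m ≤ n
APinRange⇒length≤n {n} {a} {d} {suc m} _ d₁₂ (a≥1 , last≤n) = begin
  1 + m          ≤⟨ +-mono-≤ a≥1 (m≤m*n m d {{d-nonZero d₁₂}}) ⟩
  a + m * d      ≡⟨ cong (a +_) (*-comm m d) ⟩
  a + d * m      ≤⟨ last≤n ⟩
  n              ∎
  where
  open ≤-Reasoning
  d-nonZero : Diff12 d → NonZero d
  d-nonZero (inj₁ refl) = _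
  d-nonZero (inj₂ refl) = _

APinRange⇒terms∈[n] : ∀ {n a d m x} → APinRange n a d m → InAP a d m x → 1 ≤ x × x ≤ n
APinRange⇒terms∈[n] {n} {a} {d} (a≥1 , last≤n) (i , i<m , refl) =
  ≤-trans a≥1 (m≤m+n a (d * i)) , ≤-trans (+-monoʳ-≤ a (*-monoʳ-≤ d (∸-monoˡ-≤ 1 i<m))) last≤n

multiplesInAP : ℕ → ℕ → ℕ → ℕ → ℕ
multiplesInAP p a d m = ∑[ i < m ] 𝟙 (p ∣? a + d * i)

multiplesInAP-bound : ∀ {p d} a m → Coprime p d → 1 ≤ p → p * multiplesInAP p a d m < m + p
multiplesInAP-bound {p} {d} a m p⊥d p≥1 = ∑<-sparse _ p≥1 atMostOneHit m
  where
  atMostOneHit : ∀ x → ∑[ i < p ] 𝟙 (p ∣? a + d * (x + i)) ≤ 1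
  atMostOneHit x = ∑<-atMostOne p _ (λ _ _ → 𝟙≤1 _) twoHits
    where
    twoHits : ∀ i j → i < j → j < p →
              1 ≤ 𝟙 (p ∣? a + d * (x + i)) → 1 ≤ 𝟙 (p ∣? a + d * (x + j)) → ⊥
    twoHits i j i<j j<p hit-i hit-j =
      <⇒≱ (≤-<-trans (m∸n≤m j i) j<p) (∣⇒≤ {{>-nonZero (m<n⇒0<n∸m i<j)}} p∣j∸i)
      where
      gap : a + d * (x + j) ≡ a + d * (x + i) + d * (j ∸ i)
      gap = begin
        a + d * (x + j)                 ≡⟨ cong (λ z → a + d * (x + z)) (m+[n∸m]≡n (<⇒≤ i<j)) ⟨
        a + d * (x + (i + (j ∸ i)))     ≡⟨ solve 5 (λ a d x i o → a :+ d :* (x :+ (i :+ o)) := a :+ d :* (x :+ i) :+ d :* o)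
                                             refl a d x i (j ∸ i) ⟩
        a + d * (x + i) + d * (j ∸ i)   ∎
        where open ≡-Reasoning
      p∣j∸i : p ∣ j ∸ i
      p∣j∸i = coprime-divisor p⊥d (∣m+n∣m⇒∣n (subst (p ∣_) gap (𝟙-witness _ hit-j)) (𝟙-witness _ hit-i))

smallOddPrimes : List ℕ
smallOddPrimes = 3 ∷ 5 ∷ 7 ∷ 11 ∷ 13 ∷ []

Indivisible : List ℕ → ℕ → Set
Indivisible qs x = All (λ q → ¬ q ∣ x) qs

indivisible? : ∀ qs x → Dec (Indivisible qs x)
indivisible? qs x = all? (λ q → ¬? (q ∣? x)) qs

indivisible-periodic : ∀ {qs P} → All (_∣ P) qs → ∀ x k →
                       𝟙 (indivisible? qs (x + k * P)) ≡ 𝟙 (indivisible? qs x)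
indivisible-periodic {P = P} qs∣P x k = 𝟙-cong _ _
  (λ ind → All.zipWith (λ (q∣P , q∤x+kP) q∣x → q∤x+kP (∣m∣n⇒∣m+n q∣x (∣n⇒∣m*n k q∣P))) (qs∣P , ind))
  (λ ind → All.zipWith (λ {q} (q∣P , q∤x) q∣x+kP →
    q∤x (∣m+n∣m⇒∣n (subst (q ∣_) (+-comm x (k * P)) q∣x+kP) (∣n⇒∣m*n k q∣P))) (qs∣P , ind))

freeOfSmall : ℕ → ℕ
freeOfSmall x = 𝟙 (indivisible? smallOddPrimes x)

smallOddPrimes∣15015 : All (_∣ 15015) smallOddPrimes
smallOddPrimes∣15015 = from-yes (all? (_∣? 15015) smallOddPrimes)

freeOfSmall-shift : ∀ {P} → All (_∣ P) smallOddPrimes → ∀ d a {b} → b ≡ d + a →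
                    ∑[ i < P ] freeOfSmall (b + d * i) ≡ ∑[ i < P ] freeOfSmall (a + d * i)
freeOfSmall-shift {P} qs∣P d a refl = trans (∑<-cong P λ i _ → cong freeOfSmall (step i)) (∑<-periodic-shift P h periodic)
  where
  h : ℕ → ℕ
  h i = freeOfSmall (a + d * i)
  step : ∀ i → d + a + d * i ≡ a + d * suc i
  step i = solve 3 (λ d a i → d :+ a :+ d :* i := a :+ d :* (con 1 :+ i)) refl d a i
  periodic : h P ≡ h 0
  periodic = trans (indivisible-periodic qs∣P a d)
                   (cong freeOfSmall (sym (trans (cong (a +_) (*-zeroʳ d)) (+-identityʳ a))))

-- 15015 = 3·5·7·11·13, and exactly φ(15015) = 5760 residues mod 15015 are free of these primes.
-- Leaving unification to find the arguments given explicitly here and in freeOfSmall-density (or b in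
-- freeOfSmall-shift) would make it unfold the 15015-term sum.
freeOfSmall-window : ∀ {d} → Diff12 d → ∀ a → ∑[ i < 15015 ] freeOfSmall (a + d * i) ≡ 5760
freeOfSmall-window (inj₁ refl) zero          = refl
freeOfSmall-window (inj₁ refl) (suc a)       =
  trans (freeOfSmall-shift smallOddPrimes∣15015 1 a {suc a} refl) (freeOfSmall-window (inj₁ refl) a)
freeOfSmall-window (inj₂ refl) zero          = refl
freeOfSmall-window (inj₂ refl) (suc zero)    = refl
freeOfSmall-window (inj₂ refl) (suc (suc a)) =
  trans (freeOfSmall-shift smallOddPrimes∣15015 2 a {suc (suc a)} refl) (freeOfSmall-window (inj₂ refl) a)

∑<-AP-blocks-lower : ∀ {P K} .{{_ : NonZero P}} (g : ℕ → ℕ) {d} → (∀ a → ∑[ i < P ] g (a + d * i) ≡ K) →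
                     ∀ a m → m * K ≤ ∑[ i < m ] g (a + d * i) * P + (P ∸ 1) * K
∑<-AP-blocks-lower {P} {K} g {d} windows a = ∑<-blocks-lower (λ i → g (a + d * i)) window
  where
  window : ∀ x → ∑[ i < P ] g (a + d * (x + i)) ≡ K
  window x = trans (∑<-cong P λ i _ → cong g (shift i)) (windows (a + d * x))
    where
    shift : ∀ i → a + d * (x + i) ≡ a + d * x + d * i
    shift i = solve 4 (λ a d x i → a :+ d :* (x :+ i) := a :+ d :* x :+ d :* i) refl a d x i

freeOfSmall-density : ∀ {d} → Diff12 d → ∀ a m →
                      m * 5760 ≤ ∑[ i < m ] freeOfSmall (a + d * i) * 15015 + 15014 * 5760
freeOfSmall-density {d} d₁₂ =
  ∑<-AP-blocks-lower {15015} {5760} freeOfSmall {d} (freeOfSmall-window {d} d₁₂)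

-- Odd primes shared by two numbers

prime>1 : ∀ {p} → Prime p → 1 < p
prime>1 {p} p-prime = nonTrivial⇒n>1 p {{prime⇒nonTrivial p-prime}}

oddPrime≥3 : ∀ {p} → Prime p → p ≢ 2 → 3 ≤ p
oddPrime≥3 p-prime p≢2 = ≤∧≢⇒< (prime>1 p-prime) (p≢2 ∘ sym)

oddPrime-coprime-Diff12 : ∀ {p d} → Prime p → p ≢ 2 → Diff12 d → Coprime p d
oddPrime-coprime-Diff12 p-prime p≢2 (inj₁ refl) = prime⇒coprime p-prime (prime>1 p-prime)
oddPrime-coprime-Diff12 p-prime p≢2 (inj₂ refl) = prime⇒coprime p-prime (oddPrime≥3 p-prime p≢2)

-- The bound p ≤ s only serves decidability: it is automatic when s ≥ 1.
SharesOddPrime : ℕ → ℕ → Set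
SharesOddPrime s x = ∃ λ p → p < suc s × Prime p × p ≢ 2 × p ∣ s × p ∣ x

sharesOddPrime? : ∀ s x → Dec (SharesOddPrime s x)
sharesOddPrime? s x = anyUpTo? (λ p → prime? p ×-dec ¬? (p ≟ 2) ×-dec p ∣? s ×-dec p ∣? x) (suc s)

¬SharesOddPrime⇒TwoCoprime : ∀ {s t} → 1 ≤ s → ¬ SharesOddPrime s t → TwoCoprime s t
¬SharesOddPrime⇒TwoCoprime s≥1 ¬shared p p-prime p≢2 (p∣s , p∣t) =
  ¬shared (p , s≤s (∣⇒≤ {{>-nonZero s≥1}} p∣s) , p-prime , p≢2 , p∣s , p∣t)

SharesSmallPrime : ℕ → ℕ → Set
SharesSmallPrime s x = Any (λ q → q ∣ s × q ∣ x) smallOddPrimes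

sharesSmallPrime? : ∀ s x → Dec (SharesSmallPrime s x)
sharesSmallPrime? s x = any? (λ q → q ∣? s ×-dec q ∣? x) smallOddPrimes

oddPrime<17⇒small : ∀ {p} → p < 17 → Prime p → p ≢ 2 → p ∈ smallOddPrimes
oddPrime<17⇒small = from-yes (allUpTo? (λ p → prime? p →-dec ¬? (p ≟ 2) →-dec p ∈? smallOddPrimes) 17)

largePrime? : ∀ p → Dec (17 ≤ p × Prime p)
largePrime? p = 17 ≤? p ×-dec prime? p

sharesOddPrime-split : ∀ {n s} x → s ≤ n →
  𝟙 (sharesOddPrime? s x) ≤ 𝟙 (sharesSmallPrime? s x) + ∑[ p < suc n ] (𝟙 (largePrime? p) * (𝟙 (p ∣? s) * 𝟙 (p ∣? x)))
sharesOddPrime-split {n} {s} x s≤n with sharesOddPrime? s x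
... | no _ = z≤n
... | yes (p , p<1+s , p-prime , p≢2 , p∣s , p∣x) with 17 ≤? p
...   | yes 17≤p = m≤n⇒m≤o+n (𝟙 (sharesSmallPrime? s x))
                   (≤-trans (≤-reflexive (sym large-term)) (≤∑< (suc n) shared (≤-trans p<1+s (s≤s s≤n))))
  where
  shared : ℕ → ℕ
  shared q = 𝟙 (largePrime? q) * (𝟙 (q ∣? s) * 𝟙 (q ∣? x))
  large-term : shared p ≡ 1
  large-term rewrite 𝟙-yes (largePrime? p) (17≤p , p-prime) | 𝟙-yes (p ∣? s) p∣s | 𝟙-yes (p ∣? x) p∣x = refl
...   | no 17≰p = m≤n⇒m≤n+o _ (≤-reflexive (sym (𝟙-yes (sharesSmallPrime? s x) small)))
  where
  small : SharesSmallPrime s x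
  small = Any.map (λ { refl → p∣s , p∣x }) (oddPrime<17⇒small (≰⇒> 17≰p) p-prime p≢2)

sharesSmallPrime+freeOfSmall≤1 : ∀ s x → 𝟙 (sharesSmallPrime? s x) + freeOfSmall x ≤ 1
sharesSmallPrime+freeOfSmall≤1 s x with sharesSmallPrime? s x
... | no _ = 𝟙≤1 (indivisible? smallOddPrimes x)
... | yes shared rewrite 𝟙-no (indivisible? smallOddPrimes x) (λ free → All¬⇒¬Any free (Any.map proj₂ shared)) = ≤-refl

sharesSmallPrime≤∑∈ : ∀ s x → 𝟙 (sharesSmallPrime? s x) ≤ ∑[ q ∈ smallOddPrimes ] (𝟙 (q ∣? s) * 𝟙 (q ∣? x))
sharesSmallPrime≤∑∈ s x = ≤-trans (𝟙-any≤∑∈ (λ q → q ∣? s ×-dec q ∣? x) smallOddPrimes)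
                                  (∑∈-mono′ smallOddPrimes λ q → ≤-reflexive (𝟙-× (q ∣? s) (q ∣? x)))

primeDivisorsIn : ℕ → ℕ → ℕ → ℕ
primeDivisorsIn m L s = ∑[ i < L ] (𝟙 (prime? (m + i)) * 𝟙 (m + i ∣? s))

pow-primeDivisorsIn≤ : ∀ m .{{_ : NonZero m}} L {s} → 1 ≤ s → m ^ primeDivisorsIn m L s ≤ s
pow-primeDivisorsIn≤ m zero    s≥1 = s≥1
pow-primeDivisorsIn≤ m (suc L) {s} s≥1 with prime? (m + L) | m + L ∣? s
... | no _  | _    rewrite +-identityʳ (primeDivisorsIn m L s) = pow-primeDivisorsIn≤ m L s≥1
... | yes _ | no _ rewrite +-identityʳ (primeDivisorsIn m L s) = pow-primeDivisorsIn≤ m L s≥1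
... | yes q-prime | yes (divides s′ refl) = begin
  m ^ (primeDivisorsIn m L (s′ * q) + 1)  ≡⟨ ^-distribˡ-+-* m (primeDivisorsIn m L (s′ * q)) 1 ⟩
  m ^ primeDivisorsIn m L (s′ * q) * m ^ 1 ≤⟨ *-mono-≤ (^-monoʳ-≤ m (∑<-mono L fewer)) (≤-reflexive (^-identityʳ m)) ⟩
  m ^ primeDivisorsIn m L s′ * m          ≤⟨ *-mono-≤ (pow-primeDivisorsIn≤ m L s′≥1) (m≤m+n m L) ⟩
  s′ * q                                  ∎
  where
  open ≤-Reasoning
  q = m + L
  s′≥1 : 1 ≤ s′
  s′≥1 = n≢0⇒n>0 λ s′≡0 → <⇒≱ s≥1 (≤-reflexive (cong (_* q) s′≡0))
  fewer : ∀ i → i < L → 𝟙 (prime? (m + i)) * 𝟙 (m + i ∣? s′ * q) ≤ 𝟙 (prime? (m + i)) * 𝟙 (m + i ∣? s′)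
  fewer i i<L with prime? (m + i)
  ... | no _        = z≤n
  ... | yes p-prime = *-monoʳ-≤ 1 (𝟙-mono (m + i ∣? s′ * q) (m + i ∣? s′) divides-s′)
    where
    divides-s′ : m + i ∣ s′ * q → m + i ∣ s′
    divides-s′ p∣s′q with euclidsLemma s′ q p-prime p∣s′q
    ... | inj₁ p∣s′ = p∣s′
    ... | inj₂ p∣q with prime⇒irreducible q-prime p∣q
    ...   | inj₁ p≡1 = ⊥-elim (<⇒≢ (prime>1 p-prime) (sym p≡1))
    ...   | inj₂ p≡q = ⊥-elim (<⇒≢ i<L (+-cancelˡ-≡ m i L p≡q))

largePrime⇒indivisible : ∀ {p} → 17 ≤ p → Prime p → Indivisible (2 ∷ smallOddPrimes) p
largePrime⇒indivisible {p} 17≤p p-prime = All.map noDivisor smallBounds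
  where
  smallBounds : All (λ q → 2 ≤ q × q ≤ 13) (2 ∷ smallOddPrimes)
  smallBounds = from-yes (all? (λ q → 2 ≤? q ×-dec q ≤? 13) (2 ∷ smallOddPrimes))
  noDivisor : ∀ {q} → 2 ≤ q × q ≤ 13 → ¬ q ∣ p
  noDivisor (2≤q , q≤13) q∣p with prime⇒irreducible p-prime q∣p
  ... | inj₁ refl = <⇒≱ 2≤q ≤-refl
  ... | inj₂ refl = <⇒≱ (s≤s (≤-trans q≤13 (from-yes (13 ≤? 16)))) 17≤p

-- A certificate for ∑_{17 ≤ p < 4000, p prime} 1/p² ≤ 0.017187: the weight
-- dominates 10⁶/p² on every prime p ≥ 17, and its sum is computed exactly.
weight : ℕ → ℕ
weight p = 𝟙 (17 ≤? p) * (𝟙 (indivisible? (2 ∷ smallOddPrimes) p) * ⌈ 1000000 / p * p ⌉)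

-- Opaque, so that sums up to the cutoff are never unfolded during type checking.
opaque
  primeCutoff : ℕ
  primeCutoff = 4000

  primeCutoff≡ : primeCutoff ≡ 4000
  primeCutoff≡ = refl

  ∑weight : ∑[ p < primeCutoff ] weight p ≡ 17187
  ∑weight = refl

weight-large : ∀ {p} → 17 ≤ p → Prime p → weight p ≡ ⌈ 1000000 / p * p ⌉
weight-large {p} 17≤p p-prime
  rewrite 𝟙-yes (17 ≤? p) 17≤p | 𝟙-yes (indivisible? (2 ∷ smallOddPrimes) p) (largePrime⇒indivisible 17≤p p-prime) =
  trans (+-identityʳ _) (+-identityʳ _)

-- The threshold N₀

n<2^n : ∀ n → n < 2 ^ n
n<2^n zero    = s≤s z≤n
n<2^n (suc n) = subst₂ _≤_ (+-comm (suc n) 1) (cong (2 ^ n +_) (sym (+-identityʳ (2 ^ n))))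
                  (+-mono-≤ (n<2^n n) (m^n>0 2 n))

selfPower-mono : ∀ {X Y} → 1 ≤ X → X ≤ Y → selfPower X ≤ selfPower Y
selfPower-mono {X} {Y} X≥1 X≤Y = ≤-trans (^-monoˡ-≤ X X≤Y) (^-monoʳ-≤ Y {{>-nonZero (≤-trans X≥1 X≤Y)}} X≤Y)

-- Opaque, so that the enormous number N₀ is never normalised.
opaque
  F₀ : ℕ
  F₀ = 160000

  F₀≡ : F₀ ≡ 160000
  F₀≡ = refl

N₀ : ℕ
N₀ = 2 * selfPower (2 * F₀)

-- With F = ⌊q⌋ for the q of LogCubedLt n m, n ≥ N₀ forces F ≥ F₀; then log₂ n < 1 + (2F + 2)² ≤ m/10000
-- and m > F³ ≥ 10¹⁰.
largeness : ∀ {n m} → N₀ ≤ n → LogCubedLt n m → ∃ λ b → n < 2 ^ b × b * 10000 ≤ m × 10 ^ 10 ≤ m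
largeness {n} {m} N₀≤n log with F , F³<m , n<2Y ← logCubed⇒ {n} {m} log = 1 + X * X , n<2^b , b-small , m-large
  where
  open ≤-Reasoning
  X = 2 * (F + 1)
  F-large : 160000 ≤ F
  F-large = subst (_≤ F) F₀≡ (≮⇒≥ λ F<F₀ → <⇒≱ n<2Y (begin
    2 * selfPower X     ≤⟨ *-monoʳ-≤ 2 (selfPower-mono X≥1 (*-monoʳ-≤ 2 (subst (_≤ F₀) (+-comm 1 F) F<F₀))) ⟩
    N₀                  ≤⟨ N₀≤n ⟩
    n                   ∎))
    where
    X≥1 : 1 ≤ X
    X≥1 = ≤-trans (m≤n+m 1 F) (m≤n*m (F + 1) 2)
  n<2^b : n < 2 ^ (1 + X * X)
  n<2^b = begin-strict
    n                    <⟨ n<2Y ⟩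
    2 * X ^ X            ≤⟨ *-monoʳ-≤ 2 (^-monoˡ-≤ X (<⇒≤ (n<2^n X))) ⟩
    2 * (2 ^ X) ^ X      ≡⟨ cong (2 *_) (^-*-assoc 2 X X) ⟩
    2 ^ (1 + X * X)      ∎
  X<4F : X < F * 4
  X<4F = begin-strict
    2 * (F + 1)          ≡⟨ solve 1 (λ F → con 2 :* (F :+ con 1) := F :* con 2 :+ con 2) refl F ⟩
    F * 2 + 2            <⟨ +-monoʳ-< (F * 2) (≤-trans (from-yes (3 ≤? 160000 * 2)) (*-monoˡ-≤ 2 F-large)) ⟩
    F * 2 + F * 2        ≡⟨ solve 1 (λ F → F :* con 2 :+ F :* con 2 := F :* con 4) refl F ⟩
    F * 4                ∎
  b-small : (1 + X * X) * 10000 ≤ m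
  b-small = begin
    (1 + X * X) * 10000        ≤⟨ *-monoˡ-≤ 10000 {1 + X * X} {F * 4 * (F * 4)} (≤-trans b≤ (*-mono-≤ X<4F X<4F)) ⟩
    F * 4 * (F * 4) * 10000    ≡⟨ solve 1 (λ F → F :* con 4 :* (F :* con 4) :* con 10000 := F :* F :* con 160000) refl F ⟩
    F * F * 160000             ≤⟨ *-monoʳ-≤ (F * F) F-large ⟩
    F * F * F                  ≡⟨ *-assoc F F F ⟩
    F * (F * F)                ≤⟨ <⇒≤ F³<m ⟩
    m                          ∎
    where
    b≤ : 1 + X * X ≤ suc X * suc X
    b≤ = +-mono-≤ (s≤s z≤n) (*-monoʳ-≤ X (n≤1+n X))
  m-large : 10 ^ 10 ≤ m
  m-large = ≤-trans (from-yes (10 ^ 10 ≤? 160000 * (160000 * 160000)))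
              (≤-trans (*-mono-≤ F-large (*-mono-≤ F-large F-large)) (<⇒≤ F³<m))

-- Numerical estimates

rearrangement : ∀ {a b c d} → a ≤ b → c ≤ d → a * d + b * c ≤ a * c + b * d
rearrangement {a} {c = c} a≤b c≤d
  with x , refl ← m≤n⇒∃[o]m+o≡n a≤b | y , refl ← m≤n⇒∃[o]m+o≡n c≤d = begin
  a * (c + y) + (a + x) * c             ≤⟨ m≤m+n _ (x * y) ⟩
  a * (c + y) + (a + x) * c + x * y     ≡⟨ solve 4 (λ a c x y → a :* (c :+ y) :+ (a :+ x) :* c :+ x :* y
                                                     := a :* c :+ (a :+ x) :* (c :+ y)) refl a c x y ⟩
  a * c + (a + x) * (c + y)             ∎
  where open ≤-Reasoning

+-absorb : ∀ {m} c N → c * N ≤ m → (m + c) * N ≤ m * suc N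
+-absorb {m} c N cN≤m = begin
  (m + c) * N      ≡⟨ *-distribʳ-+ N m c ⟩
  m * N + c * N    ≤⟨ +-monoʳ-≤ (m * N) cN≤m ⟩
  m * N + m        ≡⟨ solve 2 (λ m N → m :* N :+ m := m :* (con 1 :+ N)) refl m N ⟩
  m * suc N        ∎
  where open ≤-Reasoning

+-absorb² : ∀ {m} c N → c * N ≤ m → (m + c) * (m + c) * (N * N) ≤ m * m * (suc N * suc N)
+-absorb² {m} c N cN≤m = begin
  (m + c) * (m + c) * (N * N)      ≡⟨ solve 3 (λ x y N → x :* y :* (N :* N) := (x :* N) :* (y :* N)) refl (m + c) (m + c) N ⟩
  ((m + c) * N) * ((m + c) * N)    ≤⟨ *-mono-≤ (+-absorb c N cN≤m) (+-absorb c N cN≤m) ⟩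
  (m * suc N) * (m * suc N)        ≡⟨ solve 3 (λ x y N → (x :* N) :* (y :* N) := x :* y :* (N :* N)) refl m m (suc N) ⟩
  m * m * (suc N * suc N)          ∎
  where open ≤-Reasoning

linear<quadratic : ∀ {a c m} → c < m * a → m * c < m * m * a
linear<quadratic {a} {c} {zero}  ()
linear<quadratic {a} {c} {suc m} c<ma = begin-strict
  suc m * c              <⟨ *-monoʳ-< (suc m) c<ma ⟩
  suc m * (suc m * a)    ≡⟨ *-assoc (suc m) (suc m) a ⟨
  suc m * suc m * a      ∎
  where open ≤-Reasoning

-- The primes 17 ≤ p < 4000, 4000 ≤ p < m and p ≥ m account for at most 0.0172 m², 4m²/3999 and m²/20000 pairs.
largePrimes-bound : ∀ {m k L₁ L₂ L₃} → 10 ^ 10 ≤ m → k * 2 ≤ m →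
  L₁ * 1000000 ≤ (m + 4000) * (m + 4000) * 17187 → L₂ * 3999 ≤ (m * 2) * (m * 2) → L₃ * 10000 ≤ k * m →
  (L₁ + L₂ + L₃) * 100000 ≤ m * m * 1825
largePrimes-bound {m} {k} {L₁} {L₂} {L₃} m-large 2k≤m bound₁ bound₂ bound₃ = begin
  (L₁ + L₂ + L₃) * 100000                           ≡⟨ solve 3 (λ x y z → (x :+ y :+ z) :* con 100000
                                                          := x :* con 100000 :+ y :* con 100000 :+ z :* con 100000) refl L₁ L₂ L₃ ⟩
  L₁ * 100000 + L₂ * 100000 + L₃ * 100000           ≤⟨ +-mono-≤ (+-mono-≤ part₁ part₂) part₃ ⟩
  m * m * 1719 + m * m * 101 + m * m * 5            ≡⟨ solve 1 (λ m → m :* m :* con 1719 :+ m :* m :* con 101 :+ m :* m :* con 5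
                                                          := m :* m :* con 1825) refl m ⟩
  m * m * 1825                                      ∎
  where
  open ≤-Reasoning
  part₁ : L₁ * 100000 ≤ m * m * 1719
  part₁ = *-cancelʳ-≤ _ _ 10000000000000 (begin
    L₁ * 100000 * 10000000000000                            ≡⟨ solve 1 (λ x → x :* con 100000 :* con 10000000000000
                                                                  := x :* con 1000000 :* (con 1000000 :* con 1000000)) refl L₁ ⟩
    L₁ * 1000000 * (1000000 * 1000000)                      ≤⟨ *-monoˡ-≤ (1000000 * 1000000) bound₁ ⟩
    (m + 4000) * (m + 4000) * 17187 * (1000000 * 1000000)   ≡⟨ solve 1 (λ x → x :* x :* con 17187 :* (con 1000000 :* con 1000000)
                                                                  := x :* x :* (con 1000000 :* con 1000000) :* con 17187) refl (m + 4000) ⟩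
    (m + 4000) * (m + 4000) * (1000000 * 1000000) * 17187   ≤⟨ *-monoˡ-≤ 17187 (+-absorb² 4000 1000000 (≤-trans (from-yes (4000 * 1000000 ≤? 10 ^ 10)) m-large)) ⟩
    m * m * (1000001 * 1000001) * 17187                     ≡⟨ *-assoc (m * m) (1000001 * 1000001) 17187 ⟩
    m * m * (1000001 * 1000001 * 17187)                     ≤⟨ *-monoʳ-≤ (m * m) (from-yes (1000001 * 1000001 * 17187 ≤? 1719 * 10000000000000)) ⟩
    m * m * (1719 * 10000000000000)                         ≡⟨ *-assoc (m * m) 1719 10000000000000 ⟨
    m * m * 1719 * 10000000000000                           ∎)
  part₂ : L₂ * 100000 ≤ m * m * 101
  part₂ = *-cancelʳ-≤ _ _ 3999 (begin
    L₂ * 100000 * 3999              ≡⟨ solve 1 (λ x → x :* con 100000 :* con 3999 := x :* con 3999 :* con 100000) refl L₂ ⟩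
    L₂ * 3999 * 100000              ≤⟨ *-monoˡ-≤ 100000 bound₂ ⟩
    (m * 2) * (m * 2) * 100000      ≡⟨ solve 1 (λ m → (m :* con 2) :* (m :* con 2) :* con 100000 := m :* m :* con 400000) refl m ⟩
    m * m * 400000                  ≤⟨ *-monoʳ-≤ (m * m) (from-yes (400000 ≤? 101 * 3999)) ⟩
    m * m * (101 * 3999)            ≡⟨ *-assoc (m * m) 101 3999 ⟨
    m * m * 101 * 3999              ∎)
  part₃ : L₃ * 100000 ≤ m * m * 5
  part₃ = begin
    L₃ * 100000               ≡⟨ *-assoc L₃ 10000 10 ⟨
    L₃ * 10000 * 10           ≤⟨ *-monoˡ-≤ 10 bound₃ ⟩
    k * m * 10                ≡⟨ solve 2 (λ k m → k :* m :* con 10 := k :* con 2 :* m :* con 5) refl k m ⟩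
    k * 2 * m * 5             ≤⟨ *-monoˡ-≤ 5 (*-monoˡ-≤ m 2k≤m) ⟩
    m * m * 5                 ∎

-- Case r ≥ 10/3. For each s, the terms of J sharing a small prime with s and the terms free of small
-- primes (a proportion 5760/15015 ≈ 0.3836) are disjoint, so k · 0.3836 m ≤ k² + L. But k (0.3836 m - k)
-- is concave in k and exceeds L at both ends of m/16 ≤ k ≤ 3m/10: (16k - m)(3m - 10k) ≥ 0 does it.
caseA-impossible : ∀ {m k F L} → 10 ^ 10 ≤ m → m ≤ k * 16 → k * 10 ≤ m * 3 → k ≤ m →
  k * F ≤ k * k + L → m * 5760 ≤ F * 15015 + 15014 * 5760 → L * 100000 ≤ m * m * 1825 → ⊥
caseA-impossible {m} {k} {F} {L} m-large m≤16k 10k≤3m k≤m kF≤k²+L density large =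
  <⇒≱ (≤-<-trans (*-monoˡ-≤ 138369024000000 k≤m) linear<) (≤-trans (m≤n+m (m * m * 12012000) (k * m * 507300000)) combined)
  where
  open ≤-Reasoning
  linear< : m * 138369024000000 < m * m * 12012000
  linear< = linear<quadratic {12012000} {138369024000000} {m}
    (≤-trans (from-yes (138369024000001 ≤? 10 ^ 10 * 12012000)) (*-monoˡ-≤ 12012000 m-large))
  main : k * (m * 5760) ≤ (k * k + L) * 15015 + k * 86480640
  main = begin
    k * (m * 5760)                          ≤⟨ *-monoʳ-≤ k density ⟩
    k * (F * 15015 + 86480640)              ≡⟨ solve 2 (λ k F → k :* (F :* con 15015 :+ con 86480640)
                                                   := k :* F :* con 15015 :+ k :* con 86480640) refl k F ⟩
    k * F * 15015 + k * 86480640            ≤⟨ +-monoˡ-≤ (k * 86480640) (*-monoˡ-≤ 15015 kF≤k²+L) ⟩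
    (k * k + L) * 15015 + k * 86480640      ∎
  concave : m * (m * 3) + k * 16 * (k * 10) ≤ m * (k * 10) + k * 16 * (m * 3)
  concave = rearrangement m≤16k 10k≤3m
  C : ℕ
  C = k * k * 24024000000 + L * 24024000000 + k * m * 8708700000 + m * m * 438438000
  -- 1600000 · main + 150150000 · concave + 240240 · large, with C cancelled on both sides.
  combined : k * m * 507300000 + m * m * 12012000 ≤ k * 138369024000000
  combined = +-cancelˡ-≤ C (k * m * 507300000 + m * m * 12012000) (k * 138369024000000) (begin
    C + (k * m * 507300000 + m * m * 12012000)
      ≡⟨ solve 3 (λ k m L → k :* k :* con 24024000000 :+ L :* con 24024000000 :+ k :* m :* con 8708700000 :+ m :* m :* con 438438000
                   :+ (k :* m :* con 507300000 :+ m :* m :* con 12012000)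
                 := k :* (m :* con 5760) :* con 1600000 :+ (m :* (m :* con 3) :+ k :* con 16 :* (k :* con 10)) :* con 150150000
                   :+ L :* con 100000 :* con 240240) refl k m L ⟩
    k * (m * 5760) * 1600000 + (m * (m * 3) + k * 16 * (k * 10)) * 150150000 + L * 100000 * 240240
      ≤⟨ +-mono-≤ (+-mono-≤ (*-monoˡ-≤ 1600000 main) (*-monoˡ-≤ 150150000 concave)) (*-monoˡ-≤ 240240 large) ⟩
    ((k * k + L) * 15015 + k * 86480640) * 1600000 + (m * (k * 10) + k * 16 * (m * 3)) * 150150000 + m * m * 1825 * 240240
      ≡⟨ solve 3 (λ k m L → ((k :* k :+ L) :* con 15015 :+ k :* con 86480640) :* con 1600000
                   :+ (m :* (k :* con 10) :+ k :* con 16 :* (m :* con 3)) :* con 150150000 :+ m :* m :* con 1825 :* con 240240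
                 := k :* k :* con 24024000000 :+ L :* con 24024000000 :+ k :* m :* con 8708700000 :+ m :* m :* con 438438000
                   :+ k :* con 138369024000000) refl k m L ⟩
    C + k * 138369024000000 ∎)

-- 225450225 = (3·5·7·11·13)² and 41866309 = ∑_q 225450225/q² over the small odd primes q.
smallPrimes-weighted : ∀ {R} (x : ℕ → ℕ) → All (λ q → q * q * x q ≤ R) smallOddPrimes →
                       ∑[ q ∈ smallOddPrimes ] x q * 225450225 ≤ R * 41866309
smallPrimes-weighted {R} x (b₃ ∷ b₅ ∷ b₇ ∷ b₁₁ ∷ b₁₃ ∷ []) = begin
  (x 3 + (x 5 + (x 7 + (x 11 + (x 13 + 0))))) * 225450225
    ≡⟨ solve 5 (λ a b c d e → (a :+ (b :+ (c :+ (d :+ (e :+ con 0))))) :* con 225450225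
                 := con 3 :* con 3 :* a :* con 25050025 :+ con 5 :* con 5 :* b :* con 9018009 :+ con 7 :* con 7 :* c :* con 4601025
                   :+ con 11 :* con 11 :* d :* con 1863225 :+ con 13 :* con 13 :* e :* con 1334025)
               refl (x 3) (x 5) (x 7) (x 11) (x 13) ⟩
  3 * 3 * x 3 * 25050025 + 5 * 5 * x 5 * 9018009 + 7 * 7 * x 7 * 4601025 + 11 * 11 * x 11 * 1863225 + 13 * 13 * x 13 * 1334025
    ≤⟨ +-mono-≤ (+-mono-≤ (+-mono-≤ (+-mono-≤ (*-monoˡ-≤ 25050025 b₃) (*-monoˡ-≤ 9018009 b₅)) (*-monoˡ-≤ 4601025 b₇))
                          (*-monoˡ-≤ 1863225 b₁₁)) (*-monoˡ-≤ 1334025 b₁₃) ⟩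
  R * 25050025 + R * 9018009 + R * 4601025 + R * 1863225 + R * 1334025
    ≡⟨ solve 1 (λ R → R :* con 25050025 :+ R :* con 9018009 :+ R :* con 4601025 :+ R :* con 1863225 :+ R :* con 1334025
                 := R :* con 41866309) refl R ⟩
  R * 41866309 ∎
  where open ≤-Reasoning

-- Case r < 10/3: by (10k - 3m)(7m - 10k) ≥ 0 there are k ℓ ≥ k (m - k) ≥ 0.21 m² pairs, more than the
-- union bound over all odd primes allows.
caseB-impossible : ∀ {m k ℓ SB L} → 10 ^ 10 ≤ m → m * 3 ≤ k * 10 → k * 2 ≤ m → m ≤ k + ℓ →
  k * ℓ ≤ SB + L → SB * 225450225 ≤ (m + 12) * (m + 12) * 41866309 → L * 100000 ≤ m * m * 1825 → ⊥
caseB-impossible {m} {k} {ℓ} {SB} {L} m-large 3m≤10k 2k≤m m≤k+ℓ kℓ≤SB+L small large =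
  <⇒≱ (from-yes (4598085933890986630900 <? 4734454725000000000000))
      (*-cancelˡ-≤ (m * m) {{m²-nonZero}} (begin
    m * m * 4734454725000000000000                      ≡⟨ solve 1 (λ m → m :* m :* con 4734454725000000000000
                                                             := m :* m :* con 21 :* con 225450225000000000000) refl m ⟩
    m * m * 21 * 225450225000000000000                  ≤⟨ *-monoˡ-≤ 225450225000000000000 21m²≤100kℓ ⟩
    k * ℓ * 100 * 225450225000000000000                 ≤⟨ *-monoˡ-≤ 225450225000000000000 (*-monoˡ-≤ 100 kℓ≤SB+L) ⟩
    (SB + L) * 100 * 225450225000000000000              ≡⟨ solve 2 (λ s l → (s :+ l) :* con 100 :* con 225450225000000000000
                                                             := s :* con 225450225 :* con 100000000000000 :+ l :* con 100000 :* con 225450225000000000)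
                                                             refl SB L ⟩
    SB * 225450225 * 100000000000000 + L * 100000 * 225450225000000000
      ≤⟨ +-mono-≤ (*-monoˡ-≤ 100000000000000 small) (*-monoˡ-≤ 225450225000000000 large) ⟩
    (m + 12) * (m + 12) * 41866309 * 100000000000000 + m * m * 1825 * 225450225000000000
      ≡⟨ solve 2 (λ x m → x :* x :* con 41866309 :* con 100000000000000 :+ m :* m :* con 1825 :* con 225450225000000000
                   := x :* x :* (con 1000000 :* con 1000000) :* con 4186630900 :+ m :* m :* con 411446660625000000000)
                 refl (m + 12) m ⟩
    (m + 12) * (m + 12) * (1000000 * 1000000) * 4186630900 + m * m * 411446660625000000000
      ≤⟨ +-monoˡ-≤ (m * m * 411446660625000000000)
           (*-monoˡ-≤ 4186630900 (+-absorb² 12 1000000 (≤-trans (from-yes (12 * 1000000 ≤? 10 ^ 10)) m-large))) ⟩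
    m * m * (1000001 * 1000001) * 4186630900 + m * m * 411446660625000000000
      ≡⟨ solve 1 (λ m → m :* m :* (con 1000001 :* con 1000001) :* con 4186630900 :+ m :* m :* con 411446660625000000000
                   := m :* m :* con 4598085933890986630900) refl m ⟩
    m * m * 4598085933890986630900                      ∎))
  where
  open ≤-Reasoning
  m²-nonZero : NonZero (m * m)
  m²-nonZero = >-nonZero (*-mono-≤ m≥1 m≥1)
    where m≥1 = ≤-trans (from-yes (1 ≤? 10 ^ 10)) m-large
  10k≤7m : k * 10 ≤ m * 7
  10k≤7m = begin
    k * 10       ≡⟨ solve 1 (λ k → k :* con 10 := k :* con 2 :* con 5) refl k ⟩
    k * 2 * 5    ≤⟨ *-monoˡ-≤ 5 2k≤m ⟩
    m * 5        ≤⟨ *-monoʳ-≤ m (from-yes (5 ≤? 7)) ⟩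
    m * 7        ∎
  21m²≤100kℓ : m * m * 21 ≤ k * ℓ * 100
  21m²≤100kℓ = +-cancelˡ-≤ (k * k * 100) (m * m * 21) (k * ℓ * 100) (begin
    k * k * 100 + m * m * 21                   ≡⟨ solve 2 (λ k m → k :* k :* con 100 :+ m :* m :* con 21
                                                    := m :* con 3 :* (m :* con 7) :+ k :* con 10 :* (k :* con 10)) refl k m ⟩
    m * 3 * (m * 7) + k * 10 * (k * 10)        ≤⟨ rearrangement 3m≤10k 10k≤7m ⟩
    m * 3 * (k * 10) + k * 10 * (m * 7)        ≡⟨ solve 2 (λ k m → m :* con 3 :* (k :* con 10) :+ k :* con 10 :* (m :* con 7)
                                                    := k :* m :* con 100) refl k m ⟩
    k * m * 100                                ≤⟨ *-monoˡ-≤ 100 (*-monoʳ-≤ k m≤k+ℓ) ⟩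
    k * (k + ℓ) * 100                          ≡⟨ solve 2 (λ k l → k :* (k :+ l) :* con 100 := k :* k :* con 100 :+ k :* l :* con 100) refl k ℓ ⟩
    k * k * 100 + k * ℓ * 100                  ∎)

-- Counting pairs with a common odd prime factor

module PairCounting
  {a d a′ d′ m : ℕ} {S T : List ℕ}
  (d₁₂ : Diff12 d) (d′₁₂ : Diff12 d′)
  (uniqueS : Unique S) (uniqueT : Unique T)
  (S⊆I : All (InAP a d m) S) (T⊆J : All (InAP a′ d′ m) T)
  where

  k ℓ : ℕ
  k = length S
  ℓ = length T

  J : ℕ → ℕ
  J j = a′ + d′ * j

  countS countI countJ : ℕ → ℕ
  countS p = ∑[ s ∈ S ] 𝟙 (p ∣? s)
  countI p = multiplesInAP p a d m
  countJ p = multiplesInAP p a′ d′ m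

  countS≤countI : ∀ p → countS p ≤ countI p
  countS≤countI p = ∑∈-image≤∑< (λ x → 𝟙 (p ∣? x)) m (λ i → a + d * i) S uniqueS S⊆I

  oddPrime-countI : ∀ {p} → Prime p → p ≢ 2 → p * countI p < m + p
  oddPrime-countI p-prime p≢2 =
    multiplesInAP-bound a m (oddPrime-coprime-Diff12 p-prime p≢2 d₁₂) (<⇒≤ (prime>1 p-prime))

  oddPrime-countJ : ∀ {p} → Prime p → p ≢ 2 → p * countJ p < m + p
  oddPrime-countJ p-prime p≢2 =
    multiplesInAP-bound a′ m (oddPrime-coprime-Diff12 p-prime p≢2 d′₁₂) (<⇒≤ (prime>1 p-prime))

  oddPrime-countS : ∀ {p} → Prime p → p ≢ 2 → p * countS p < m + p
  oddPrime-countS {p} p-prime p≢2 = ≤-<-trans (*-monoʳ-≤ p (countS≤countI p)) (oddPrime-countI p-prime p≢2)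

  sharedWithJ smallSharedWithJ : ℕ → ℕ
  sharedWithJ      s = ∑[ j < m ] 𝟙 (sharesOddPrime? s (J j))
  smallSharedWithJ s = ∑[ j < m ] 𝟙 (sharesSmallPrime? s (J j))

  kℓ≤∑sharedWithJ : All (λ s → All (SharesOddPrime s) T) S → k * ℓ ≤ ∑[ s ∈ S ] sharedWithJ s
  kℓ≤∑sharedWithJ allShare = begin
    k * ℓ                  ≡⟨ ∑∈-const S ℓ ⟨
    ∑[ s ∈ S ] ℓ           ≤⟨ ∑∈-mono S (All.map ℓ≤sharedWithJ allShare) ⟩
    ∑[ s ∈ S ] sharedWithJ s ∎
    where
    open ≤-Reasoning
    ℓ≤sharedWithJ : ∀ {s} → All (SharesOddPrime s) T → ℓ ≤ sharedWithJ s
    ℓ≤sharedWithJ {s} shares = begin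
      ℓ                                        ≡⟨ trans (sym (*-identityʳ ℓ)) (sym (∑∈-const T 1)) ⟩
      ∑[ t ∈ T ] 1                             ≤⟨ ∑∈-mono T (All.map (λ sh → ≤-reflexive (sym (𝟙-yes (sharesOddPrime? s _) sh))) shares) ⟩
      ∑[ t ∈ T ] 𝟙 (sharesOddPrime? s t)       ≤⟨ ∑∈-image≤∑< (λ t → 𝟙 (sharesOddPrime? s t)) m J T uniqueT T⊆J ⟩
      sharedWithJ s                            ∎

  sharedWithJ-split : ∀ {n} s → s ≤ n →
    sharedWithJ s ≤ smallSharedWithJ s + ∑[ p < suc n ] (𝟙 (largePrime? p) * (𝟙 (p ∣? s) * countJ p))
  sharedWithJ-split {n} s s≤n = begin
    sharedWithJ s
      ≤⟨ ∑<-mono m (λ j _ → sharesOddPrime-split (J j) s≤n) ⟩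
    ∑[ j < m ] (𝟙 (sharesSmallPrime? s (J j)) + ∑[ p < suc n ] shared p j)
      ≡⟨ ∑<-distrib-+ m ⟩
    smallSharedWithJ s + ∑[ j < m ] ∑[ p < suc n ] shared p j
      ≡⟨ cong (smallSharedWithJ s +_) (∑<-comm m (suc n) (λ j p → shared p j)) ⟩
    smallSharedWithJ s + ∑[ p < suc n ] ∑[ j < m ] shared p j
      ≡⟨ cong (smallSharedWithJ s +_) (∑<-cong (suc n) λ p _ → factor p) ⟩
    smallSharedWithJ s + ∑[ p < suc n ] (large p * (𝟙 (p ∣? s) * countJ p)) ∎
    where
    open ≤-Reasoning
    large : ℕ → ℕ
    large p = 𝟙 (largePrime? p)
    shared : ℕ → ℕ → ℕ
    shared p j = large p * (𝟙 (p ∣? s) * 𝟙 (p ∣? J j))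
    factor : ∀ p → ∑[ j < m ] shared p j ≡ large p * (𝟙 (p ∣? s) * countJ p)
    factor p = trans (∑<-*ˡ m (large p) _) (cong (large p *_) (∑<-*ˡ m (𝟙 (p ∣? s)) _))

  largePrimePairs : ℕ → ℕ
  largePrimePairs p = 𝟙 (largePrime? p) * (countS p * countJ p)

  ∑sharedWithJ-split : ∀ {n} → All (_≤ n) S →
    ∑[ s ∈ S ] sharedWithJ s ≤ ∑[ s ∈ S ] smallSharedWithJ s + ∑[ p < suc n ] largePrimePairs p
  ∑sharedWithJ-split {n} S≤n = begin
    ∑[ s ∈ S ] sharedWithJ s
      ≤⟨ ∑∈-mono S (All.map (λ {s} → sharedWithJ-split s) S≤n) ⟩
    ∑[ s ∈ S ] (smallSharedWithJ s + ∑[ p < suc n ] shared s p)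
      ≡⟨ ∑∈-distrib-+ S ⟩
    ∑[ s ∈ S ] smallSharedWithJ s + ∑[ s ∈ S ] ∑[ p < suc n ] shared s p
      ≡⟨ cong (∑[ s ∈ S ] smallSharedWithJ s +_) (∑∈-∑<-comm S (suc n) shared) ⟩
    ∑[ s ∈ S ] smallSharedWithJ s + ∑[ p < suc n ] ∑[ s ∈ S ] shared s p
      ≡⟨ cong (∑[ s ∈ S ] smallSharedWithJ s +_) (∑<-cong (suc n) λ p _ → factor p) ⟩
    ∑[ s ∈ S ] smallSharedWithJ s + ∑[ p < suc n ] largePrimePairs p ∎
    where
    open ≤-Reasoning
    shared : ℕ → ℕ → ℕ
    shared s p = 𝟙 (largePrime? p) * (𝟙 (p ∣? s) * countJ p)
    factor : ∀ p → ∑[ s ∈ S ] shared s p ≡ largePrimePairs p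
    factor p = trans (∑∈-*ˡ S (𝟙 (largePrime? p)) _) (cong (𝟙 (largePrime? p) *_) (∑∈-*ʳ S (countJ p) (λ s → 𝟙 (p ∣? s))))

  largePrimePairs-cases : ∀ p → largePrimePairs p ≡ 0 ⊎ (17 ≤ p × Prime p × largePrimePairs p ≡ countS p * countJ p)
  largePrimePairs-cases p = cases (largePrime? p)
    where
    cases : (D : Dec (17 ≤ p × Prime p)) →
            𝟙 D * (countS p * countJ p) ≡ 0 ⊎ (17 ≤ p × Prime p × 𝟙 D * (countS p * countJ p) ≡ countS p * countJ p)
    cases (yes (17≤p , p-prime)) = inj₂ (17≤p , p-prime , +-identityʳ _)
    cases (no _)                 = inj₁ refl

  private
    large⇒odd : ∀ {p} → 17 ≤ p → p ≢ 2
    large⇒odd 17≤p refl with 17≤p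
    ... | s≤s (s≤s ())

    *-square : ∀ p x y → p * p * (x * y) ≡ (p * x) * (p * y)
    *-square = solve 3 (λ p x y → p :* p :* (x :* y) := (p :* x) :* (p :* y)) refl

  lowPrimes-bound : ∀ B → ∑[ p < B ] largePrimePairs p * 1000000 ≤ (m + B) * (m + B) * ∑[ p < B ] weight p
  lowPrimes-bound B = begin
    ∑< B largePrimePairs * 1000000                    ≡⟨ ∑<-*ʳ B 1000000 largePrimePairs ⟨
    ∑[ p < B ] (largePrimePairs p * 1000000)          ≤⟨ ∑<-mono B perPrime ⟩
    ∑[ p < B ] ((m + B) * (m + B) * weight p)   ≡⟨ ∑<-*ˡ B ((m + B) * (m + B)) weight ⟩
    (m + B) * (m + B) * ∑< B weight             ∎
    where
    open ≤-Reasoning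
    perPrime : ∀ p → p < B → largePrimePairs p * 1000000 ≤ (m + B) * (m + B) * weight p
    perPrime p p<B with largePrimePairs-cases p
    ... | inj₁ ≡0 rewrite ≡0 = z≤n
    ... | inj₂ (17≤p , p-prime , eq) rewrite eq | weight-large 17≤p p-prime = begin
      countS p * countJ p * 1000000                    ≤⟨ *-monoʳ-≤ (countS p * countJ p) (≤⌈/⌉* 1000000 (*-mono-≤ p≥1 p≥1)) ⟩
      countS p * countJ p * (w * (p * p))              ≡⟨ solve 4 (λ x y w p → x :* y :* (w :* (p :* p)) := p :* p :* (x :* y) :* w) refl (countS p) (countJ p) w p ⟩
      p * p * (countS p * countJ p) * w                ≡⟨ cong (_* w) (*-square p (countS p) (countJ p)) ⟩
      (p * countS p) * (p * countJ p) * w              ≤⟨ *-monoˡ-≤ w (*-mono-≤ (below (oddPrime-countS p-prime p≢2)) (below (oddPrime-countJ p-prime p≢2))) ⟩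
      (m + B) * (m + B) * w                            ∎
      where
      w = ⌈ 1000000 / p * p ⌉
      p≢2 = large⇒odd 17≤p
      p≥1 : 1 ≤ p
      p≥1 = ≤-trans (s≤s z≤n) 17≤p
      below : ∀ {x} → x < m + p → x ≤ m + B
      below x<m+p = ≤-trans (<⇒≤ x<m+p) (+-monoʳ-≤ m (<⇒≤ p<B))

  midPrimes-bound : ∀ B → 1 ≤ B → B ≤ m → ∑[ i < m ∸ B ] largePrimePairs (B + i) * (B ∸ 1) ≤ (m * 2) * (m * 2)
  midPrimes-bound (suc b) _ b<m = ∑<-inverseSquares b (m ∸ suc b) (λ i → largePrimePairs (suc b + i)) perPrime
    where
    perPrime : ∀ i → i < m ∸ suc b → (suc b + i) * (suc b + i) * largePrimePairs (suc b + i) ≤ (m * 2) * (m * 2)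
    perPrime i i<m∸b with largePrimePairs-cases (suc b + i)
    ... | inj₁ ≡0 rewrite ≡0 | *-zeroʳ ((suc b + i) * (suc b + i)) = z≤n
    ... | inj₂ (17≤p , p-prime , eq) rewrite eq | *-square (suc b + i) (countS (suc b + i)) (countJ (suc b + i)) =
      *-mono-≤ (below (oddPrime-countS p-prime p≢2)) (below (oddPrime-countJ p-prime p≢2))
      where
      p = suc b + i
      p≢2 = large⇒odd 17≤p
      p<m : p < m
      p<m = subst (_≤ m) (cong suc (+-comm i (suc b))) (m≤o∸n⇒m+n≤o (suc i) b<m i<m∸b)
      below : ∀ {x} → x < m + p → x ≤ m * 2
      below x<m+p = ≤-trans (<⇒≤ x<m+p) (≤-trans (+-monoʳ-≤ m (<⇒≤ p<m)) (≤-reflexive (solve 1 (λ m → m :+ m := m :* con 2) refl m)))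

  highPrimes-bound : ∀ L → ∑[ i < L ] largePrimePairs (m + i) ≤ ∑[ s ∈ S ] primeDivisorsIn m L s
  highPrimes-bound L = begin
    ∑[ i < L ] largePrimePairs (m + i)                                  ≤⟨ ∑<-mono L (λ i _ → perPrime (m + i) (m≤m+n m i)) ⟩
    ∑[ i < L ] (𝟙 (prime? (m + i)) * countS (m + i))              ≡⟨ ∑<-cong L (λ i _ → sym (∑∈-*ˡ S (𝟙 (prime? (m + i))) _)) ⟩
    ∑[ i < L ] ∑[ s ∈ S ] (𝟙 (prime? (m + i)) * 𝟙 (m + i ∣? s))   ≡⟨ ∑∈-∑<-comm S L (λ s i → 𝟙 (prime? (m + i)) * 𝟙 (m + i ∣? s)) ⟨
    ∑[ s ∈ S ] primeDivisorsIn m L s                              ∎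
    where
    open ≤-Reasoning
    perPrime : ∀ p → m ≤ p → largePrimePairs p ≤ 𝟙 (prime? p) * countS p
    perPrime p m≤p with largePrimePairs-cases p
    ... | inj₁ ≡0 rewrite ≡0 = z≤n
    ... | inj₂ (17≤p , p-prime , eq) rewrite eq | 𝟙-yes (prime? p) p-prime | +-identityʳ (countS p) = begin
      countS p * countJ p    ≤⟨ *-monoʳ-≤ (countS p) countJ≤1 ⟩
      countS p * 1           ≡⟨ *-identityʳ (countS p) ⟩
      countS p               ∎
      where
      countJ≤1 : countJ p ≤ 1
      countJ≤1 = ≮⇒≥ λ 2≤c → <-irrefl refl (<-≤-trans (oddPrime-countJ p-prime (large⇒odd 17≤p)) (begin
        m + p         ≤⟨ +-monoˡ-≤ p m≤p ⟩
        p + p         ≡⟨ solve 1 (λ p → p :+ p := p :* con 2) refl p ⟩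
        p * 2         ≤⟨ *-monoʳ-≤ p 2≤c ⟩
        p * countJ p  ∎))

  freeInJ : ℕ
  freeInJ = ∑[ j < m ] freeOfSmall (J j)

  smallShared+freeInJ≤km : ∑[ s ∈ S ] smallSharedWithJ s + k * freeInJ ≤ k * m
  smallShared+freeInJ≤km = begin
    ∑[ s ∈ S ] smallSharedWithJ s + k * freeInJ               ≡⟨ cong (∑[ s ∈ S ] smallSharedWithJ s +_) (∑∈-const S freeInJ) ⟨
    ∑[ s ∈ S ] smallSharedWithJ s + ∑[ s ∈ S ] freeInJ        ≡⟨ ∑∈-distrib-+ S ⟨
    ∑[ s ∈ S ] (smallSharedWithJ s + freeInJ)                 ≤⟨ ∑∈-mono′ S perS ⟩
    ∑[ s ∈ S ] m                                              ≡⟨ ∑∈-const S m ⟩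
    k * m                                                     ∎
    where
    open ≤-Reasoning
    perS : ∀ s → smallSharedWithJ s + freeInJ ≤ m
    perS s = begin
      smallSharedWithJ s + freeInJ                                     ≡⟨ ∑<-distrib-+ m ⟨
      ∑[ j < m ] (𝟙 (sharesSmallPrime? s (J j)) + freeOfSmall (J j))   ≤⟨ ∑<-mono m (λ j _ → sharesSmallPrime+freeOfSmall≤1 s (J j)) ⟩
      ∑[ j < m ] 1                                                     ≡⟨ trans (∑<-const m 1) (*-identityʳ m) ⟩
      m                                                                ∎

  smallShared≤∑countI*countJ : ∑[ s ∈ S ] smallSharedWithJ s ≤ ∑[ q ∈ smallOddPrimes ] (countI q * countJ q)
  smallShared≤∑countI*countJ = begin
    ∑[ s ∈ S ] smallSharedWithJ s                                ≤⟨ ∑∈-mono′ S perS ⟩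
    ∑[ s ∈ S ] ∑[ q ∈ smallOddPrimes ] (𝟙 (q ∣? s) * countJ q)   ≡⟨ ∑∈-comm S smallOddPrimes (λ s q → 𝟙 (q ∣? s) * countJ q) ⟩
    ∑[ q ∈ smallOddPrimes ] ∑[ s ∈ S ] (𝟙 (q ∣? s) * countJ q)   ≡⟨ ∑∈-cong smallOddPrimes (λ q → ∑∈-*ʳ S (countJ q) (λ s → 𝟙 (q ∣? s))) ⟩
    ∑[ q ∈ smallOddPrimes ] (countS q * countJ q)                ≤⟨ ∑∈-mono′ smallOddPrimes (λ q → *-monoˡ-≤ (countJ q) (countS≤countI q)) ⟩
    ∑[ q ∈ smallOddPrimes ] (countI q * countJ q)                ∎
    where
    open ≤-Reasoning
    perS : ∀ s → smallSharedWithJ s ≤ ∑[ q ∈ smallOddPrimes ] (𝟙 (q ∣? s) * countJ q)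
    perS s = begin
      smallSharedWithJ s                                                   ≤⟨ ∑<-mono m (λ j _ → sharesSmallPrime≤∑∈ s (J j)) ⟩
      ∑[ j < m ] ∑[ q ∈ smallOddPrimes ] (𝟙 (q ∣? s) * 𝟙 (q ∣? J j))      ≡⟨ ∑∈-∑<-comm smallOddPrimes m (λ q j → 𝟙 (q ∣? s) * 𝟙 (q ∣? J j)) ⟨
      ∑[ q ∈ smallOddPrimes ] ∑[ j < m ] (𝟙 (q ∣? s) * 𝟙 (q ∣? J j))      ≡⟨ ∑∈-cong smallOddPrimes (λ q → ∑<-*ˡ m (𝟙 (q ∣? s)) (λ j → 𝟙 (q ∣? J j))) ⟩
      ∑[ q ∈ smallOddPrimes ] (𝟙 (q ∣? s) * countJ q)                     ∎

  smallPrime-squares : All (λ q → q * q * (countI q * countJ q) ≤ (m + 12) * (m + 12)) smallOddPrimes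
  smallPrime-squares = All.map perPrime smallOddPrimes-prime
    where
    smallOddPrimes-prime : All (λ q → Prime q × q ≢ 2 × q ≤ 13) smallOddPrimes
    smallOddPrimes-prime = from-yes (all? (λ q → prime? q ×-dec ¬? (q ≟ 2) ×-dec q ≤? 13) smallOddPrimes)
    perPrime : ∀ {q} → Prime q × q ≢ 2 × q ≤ 13 → q * q * (countI q * countJ q) ≤ (m + 12) * (m + 12)
    perPrime {q} (q-prime , q≢2 , q≤13) rewrite *-square q (countI q) (countJ q) =
      *-mono-≤ (below (oddPrime-countI q-prime q≢2)) (below (oddPrime-countJ q-prime q≢2))
      where
      below : ∀ {x} → x < m + q → x ≤ m + 12
      below x<m+q = ≤-pred (≤-trans x<m+q (≤-trans (+-monoʳ-≤ m q≤13) (≤-reflexive (+-suc m 12))))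

  module _ {n : ℕ} (S⊆[n] : All (λ s → 1 ≤ s × s ≤ n) S) where

    smallShared largeShared : ℕ
    smallShared = ∑[ s ∈ S ] smallSharedWithJ s
    largeShared = ∑[ p < suc n ] largePrimePairs p

    allShare⇒kℓ≤ : All (λ s → All (SharesOddPrime s) T) S → k * ℓ ≤ smallShared + largeShared
    allShare⇒kℓ≤ allShare = ≤-trans (kℓ≤∑sharedWithJ allShare) (∑sharedWithJ-split (All.map proj₂ S⊆[n]))

    largeShared-bound : ∀ {b} → m ≤ n → n < 2 ^ b → b * 10000 ≤ m → 10 ^ 10 ≤ m → k * 2 ≤ m →
                        largeShared * 100000 ≤ m * m * 1825
    largeShared-bound {b} m≤n n<2^b b-small m-large 2k≤m = begin
      largeShared * 100000               ≡⟨ cong (_* 100000) ranges ⟩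
      (L₁ + L₂ + L₃) * 100000            ≤⟨ largePrimes-bound {m} {k} {L₁} {L₂} {L₃} m-large 2k≤m bound₁ bound₂ bound₃ ⟩
      m * m * 1825                       ∎
      where
      open ≤-Reasoning
      L₁ L₂ L₃ : ℕ
      L₁ = ∑[ p < primeCutoff ] largePrimePairs p
      L₂ = ∑[ i < m ∸ primeCutoff ] largePrimePairs (primeCutoff + i)
      L₃ = ∑[ i < suc n ∸ m ] largePrimePairs (m + i)
      4000≤m : 4000 ≤ m
      4000≤m = ≤-trans (from-yes (4000 ≤? 10 ^ 10)) m-large
      cutoff≤m : primeCutoff ≤ m
      cutoff≤m = subst (_≤ m) (sym primeCutoff≡) 4000≤m
      ranges : largeShared ≡ L₁ + L₂ + L₃
      ranges = trans (∑<-split-at largePrimePairs (m≤n⇒m≤1+n m≤n)) (cong (_+ L₃) (∑<-split-at largePrimePairs cutoff≤m))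
      bound₁ : L₁ * 1000000 ≤ (m + 4000) * (m + 4000) * 17187
      bound₁ = subst₂ (λ B w → L₁ * 1000000 ≤ (m + B) * (m + B) * w) primeCutoff≡ ∑weight (lowPrimes-bound primeCutoff)
      bound₂ : L₂ * 3999 ≤ (m * 2) * (m * 2)
      bound₂ = subst (λ B → L₂ * (B ∸ 1) ≤ (m * 2) * (m * 2)) primeCutoff≡
                 (midPrimes-bound primeCutoff (subst (1 ≤_) (sym primeCutoff≡) (s≤s z≤n)) cutoff≤m)
      primeDivisors≤b : ∀ {s} → 1 ≤ s × s ≤ n → primeDivisorsIn m (suc n ∸ m) s ≤ b
      primeDivisors≤b {s} (s≥1 , s≤n) = ≮⇒≥ λ b<ω → <⇒≱ n<2^b (begin
        2 ^ b      ≤⟨ ^-monoʳ-≤ 2 (<⇒≤ b<ω) ⟩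
        2 ^ ω      ≤⟨ ^-monoˡ-≤ ω (≤-trans (from-yes (2 ≤? 4000)) 4000≤m) ⟩
        m ^ ω      ≤⟨ pow-primeDivisorsIn≤ m {{>-nonZero (≤-trans (s≤s z≤n) 4000≤m)}} (suc n ∸ m) s≥1 ⟩
        s          ≤⟨ s≤n ⟩
        n          ∎)
        where ω = primeDivisorsIn m (suc n ∸ m) s
      bound₃ : L₃ * 10000 ≤ k * m
      bound₃ = begin
        L₃ * 10000                                         ≤⟨ *-monoˡ-≤ 10000 (highPrimes-bound (suc n ∸ m)) ⟩
        ∑[ s ∈ S ] primeDivisorsIn m (suc n ∸ m) s * 10000 ≤⟨ *-monoˡ-≤ 10000 (∑∈-mono S (All.map primeDivisors≤b S⊆[n])) ⟩
        ∑[ s ∈ S ] b * 10000                               ≡⟨ cong (_* 10000) (∑∈-const S b) ⟩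
        k * b * 10000                                      ≡⟨ *-assoc k b 10000 ⟩
        k * (b * 10000)                                    ≤⟨ *-monoʳ-≤ k b-small ⟩
        k * m                                              ∎

coprimePair : ∀ {S T} → All (1 ≤_) S → ¬ All (λ s → All (SharesOddPrime s) T) S →
              ∃ λ s → ∃ λ t → s ∈ S × t ∈ T × TwoCoprime s t
coprimePair {S} {T} S≥1 notAllShare
  with s , s∈S , notAllShareWith-s ← find (¬All⇒Any¬ (λ s → all? (sharesOddPrime? s) T) S notAllShare)
  with t , t∈T , ¬shared ← find (¬All⇒Any¬ (sharesOddPrime? s) T notAllShareWith-s)
  = s , t , s∈S , t∈T , ¬SharesOddPrime⇒TwoCoprime (lookup S≥1 s∈S) ¬shared

allShare-impossible : ∀ {n m a d a′ d′ S T} → Diff12 d → Diff12 d′ → Unique S → Unique T →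
  All (InAP a d m) S → All (InAP a′ d′ m) T → All (λ s → 1 ≤ s × s ≤ n) S → m ≤ n →
  m ≤ length S + length T → length S * 2 ≤ m → m ≤ length S * 16 →
  (∃ λ b → n < 2 ^ b × b * 10000 ≤ m × 10 ^ 10 ≤ m) →
  ¬ All (λ s → All (SharesOddPrime s) T) S
allShare-impossible {n} {m} {a} {d} {a′} {d′} {S} {T} d₁₂ d′₁₂ uniqueS uniqueT S⊆I T⊆J S⊆[n] m≤n m≤k+ℓ 2k≤m m≤16k
                    (b , n<2^b , b-small , m-large) allShare = split (k * 10 ≤? m * 3)
  where
  open PairCounting d₁₂ d′₁₂ uniqueS uniqueT S⊆I T⊆J
  SB L : ℕ
  SB = smallShared S⊆[n]
  L  = largeShared S⊆[n]
  pairs : k * ℓ ≤ SB + L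
  pairs = allShare⇒kℓ≤ S⊆[n] allShare
  large : L * 100000 ≤ m * m * 1825
  large = largeShared-bound S⊆[n] {b} m≤n n<2^b b-small m-large 2k≤m
  split : Dec (k * 10 ≤ m * 3) → ⊥
  split (yes 10k≤3m) = caseA-impossible {m} {k} {freeInJ} {L} m-large m≤16k 10k≤3m (≤-trans (m≤m*n k 2) 2k≤m)
                         kFree≤k²+L (freeOfSmall-density d′₁₂ a′ m) large
    where
    kFree≤k²+L : k * freeInJ ≤ k * k + L
    kFree≤k²+L = +-cancelˡ-≤ SB (k * freeInJ) (k * k + L) (begin
      SB + k * freeInJ        ≤⟨ smallShared+freeInJ≤km ⟩
      k * m                   ≤⟨ *-monoʳ-≤ k m≤k+ℓ ⟩
      k * (k + ℓ)             ≡⟨ *-distribˡ-+ k k ℓ ⟩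
      k * k + k * ℓ           ≤⟨ +-monoʳ-≤ (k * k) pairs ⟩
      k * k + (SB + L)        ≡⟨ solve 3 (λ x s l → x :+ (s :+ l) := s :+ (x :+ l)) refl (k * k) SB L ⟩
      SB + (k * k + L)        ∎)
      where open ≤-Reasoning
  split (no 10k≰3m) = caseB-impossible {m} {k} {ℓ} {SB} {L} m-large (<⇒≤ (≰⇒> 10k≰3m)) 2k≤m m≤k+ℓ pairs
                        (≤-trans (*-monoˡ-≤ 225450225 smallShared≤∑countI*countJ)
                                 (smallPrimes-weighted (λ q → countI q * countJ q) smallPrime-squares))
                        large

lemma2p6 : ∃ λ (N₀ : ℕ) → ∀ (n : ℕ) → N₀ ≤ n → ∀ (m : ℕ) → 1 ≤ m
    → ∀ (a d a′ d′ : ℕ) → Diff12 d → Diff12 d′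
    → APinRange n a d m → APinRange n a′ d′ m
    → ∀ (S T : List ℕ) → Unique S → Unique T
    → All (InAP a d m) S → All (InAP a′ d′ m) T
    → 1 ≤ length S → 1 ≤ length T
    → m ≤ length S + length T
    → 2 * length S ≤ m → m ≤ 16 * length S
    → LogCubedLt n m
    → ∃ λ s → ∃ λ t → s ∈ S × t ∈ T × TwoCoprime s t
lemma2p6 = N₀ , λ n N₀≤n m m≥1 a d a′ d′ d₁₂ d′₁₂ I⊆[n] _ S T uniqueS uniqueT S⊆I T⊆J _ _ m≤k+ℓ 2k≤m m≤16k log →
  let S⊆[n] = All.map (APinRange⇒terms∈[n] {n} {a} {d} {m} I⊆[n]) S⊆I in
  case all? (λ s → all? (sharesOddPrime? s) T) S of λ where
    (yes allShare)   → ⊥-elim (allShare-impossible d₁₂ d′₁₂ uniqueS uniqueT S⊆I T⊆J S⊆[n]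
                          (APinRange⇒length≤n {n} {a} {d} {m} m≥1 d₁₂ I⊆[n]) m≤k+ℓ
                          (subst (_≤ m) (*-comm 2 (length S)) 2k≤m) (subst (m ≤_) (*-comm 16 (length S)) m≤16k)
                          (largeness {n} {m} N₀≤n log) allShare)
    (no notAllShare) → coprimePair (All.map proj₁ S⊆[n]) notAllShare
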